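{- Let $w\ge 0$ and let $\mathcal{B}$ be a class of graphs such that $\operatorname{tw}(L(B))\le w$ for every $B\in\mathcal{B}$. Let $\mathcal{C}$ be the class of graphs arising from graphs in $\mathcal{B}$ by successively applying the bridge operation (to graphs already obtained). Then every $G\in\mathcal{C}$ satisfies $\operatorname{tw}(G)\le 2w+1$.
   Context: Bridge operation: given vertex-disjoint graphs $G_1,G_2$ and vertices $v_1\in V(G_1)$, $v_2\in V(G_2)$ with neighborhoods $N(v_1)=\{x_1,y_1,z_1\}$, $N(v_2)=\{x_2,y_2,z_2\}$ (each of size three), it produces $(G_1-v_1)\cup(G_2-v_2)+x_1x_2+y_1y_2+z_1z_2$. $L(F)$ denotes the line graph of $F$ (vertex set $E(F)$, two vertices adjacent iff the edges share an endvertex), and $\operatorname{tw}$ denotes treewidth. -}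

module Defs where

open import Data.Nat using (ℕ; zero; suc; _≤_; _<ᵇ_)
open import Data.Fin using (Fin; toℕ; splitAt; punchIn; _≟_)
open import Data.Fin.Base using (_↑ˡ_)
open import Data.Bool using (Bool; true; false; _∧_; _∨_; not; if_then_else_)
open import Data.List using (List; []; _∷_; [_]; _++_; length; lookup; concatMap; allFin)
open import Data.List.Membership.Propositional using (_∈_)
open import Data.List.Relation.Unary.Unique.Propositional using (Unique)
open import Data.List.Relation.Unary.Linked using (Linked)
open import Data.Product using (Σ; ∃; _×_; _,_)
open import Data.Sum using (_⊎_; inj₁; inj₂)
open import Data.Unit using (⊤)
open import Data.Empty using (⊥-elim)
open import Relation.Nullary using (¬_; yes; no)
open import Relation.Nullary.Decidable using (⌊_⌋)
open import Relation.Binary.PropositionalEquality using (_≡_; _≢_; refl; sym)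

record Graph : Set where
  constructor mkGraph
  field
    n     : ℕ
    adj   : Fin n → Fin n → Bool
    adj-sym : ∀ i j → adj i j ≡ adj j i
    adj-irr : ∀ i → adj i i ≡ false

open Graph public

Adj : (G : Graph) → Fin (n G) → Fin (n G) → Set
Adj G u v = adj G u v ≡ true

eqb : ∀ {m} → Fin m → Fin m → Bool
eqb a b = ⌊ a ≟ b ⌋

eqb-sym : ∀ {m} (a b : Fin m) → eqb a b ≡ eqb b a
eqb-sym a b with a ≟ b | b ≟ a
... | yes _ | yes _ = refl
... | no _  | no _  = refl
... | yes p | no q  = ⊥-elim (q (sym p))
... | no p  | yes q = ⊥-elim (p (sym q))

eqb-refl : ∀ {m} (a : Fin m) → eqb a a ≡ true
eqb-refl a with a ≟ a
... | yes _ = refl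
... | no p  = ⊥-elim (p refl)

-- Line graph L(F): vertices are the edges of F (each edge {i,j} listed
-- once as the pair (i , j) with i < j); two distinct edges are adjacent
-- iff they share an endvertex.

edges : (F : Graph) → List (Fin (n F) × Fin (n F))
edges F = concatMap (λ i → concatMap (λ j →
            if (toℕ i <ᵇ toℕ j) ∧ adj F i j then [ (i , j) ] else [])
            (allFin (n F))) (allFin (n F))

share : ∀ {m} → Fin m × Fin m → Fin m × Fin m → Bool
share (a , b) (c , d) = eqb a c ∨ eqb a d ∨ eqb b c ∨ eqb b d

private
  swap-mid : ∀ p q r s → p ∨ q ∨ r ∨ s ≡ p ∨ r ∨ q ∨ s
  swap-mid true  q r s = refl
  swap-mid false true true s = refl
  swap-mid false true false s = refl
  swap-mid false false r s = refl

share-sym : ∀ {m} (e f : Fin m × Fin m) → share e f ≡ share f e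
share-sym (a , b) (c , d)
  rewrite eqb-sym c a | eqb-sym c b | eqb-sym d a | eqb-sym d b
  = swap-mid (eqb a c) (eqb a d) (eqb b c) (eqb b d)

lineGraph : Graph → Graph
lineGraph F = mkGraph (length es) ladj lsym lirr
  where
  es = edges F
  ladj : Fin (length es) → Fin (length es) → Bool
  ladj k l = not (eqb k l) ∧ share (lookup es k) (lookup es l)
  lsym : ∀ k l → ladj k l ≡ ladj l k
  lsym k l rewrite eqb-sym k l | share-sym (lookup es k) (lookup es l) = refl
  lirr : ∀ k → ladj k k ≡ false
  lirr k rewrite eqb-refl k = refl

-- Vertex deletion G - v (vertices of G - v are Fin (n-1), embedded into
-- G via punchIn v).

del : (G : Graph) → Fin (n G) → Graph
del (mkGraph (suc m) a s r) v =
  mkGraph m (λ i j → a (punchIn v i) (punchIn v j))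
            (λ i j → s (punchIn v i) (punchIn v j))
            (λ i → r (punchIn v i))

delEmb : (G : Graph) (v : Fin (n G)) → Fin (n (del G v)) → Fin (n G)
delEmb (mkGraph (suc m) a s r) v = punchIn v

private
  uadj : ∀ {m₁ m₂} → (Fin m₁ → Fin m₁ → Bool) → (Fin m₂ → Fin m₂ → Bool)
       → (Fin m₁ → Fin m₂ → Bool) → Fin m₁ ⊎ Fin m₂ → Fin m₁ ⊎ Fin m₂ → Bool
  uadj a₁ a₂ c (inj₁ x) (inj₁ y) = a₁ x y
  uadj a₁ a₂ c (inj₂ x) (inj₂ y) = a₂ x y
  uadj a₁ a₂ c (inj₁ x) (inj₂ y) = c x y
  uadj a₁ a₂ c (inj₂ x) (inj₁ y) = c y x

  uadj-sym : ∀ {m₁ m₂} (a₁ : Fin m₁ → Fin m₁ → Bool) (a₂ : Fin m₂ → Fin m₂ → Bool)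
           (c : Fin m₁ → Fin m₂ → Bool)
           → (∀ x y → a₁ x y ≡ a₁ y x) → (∀ x y → a₂ x y ≡ a₂ y x)
           → ∀ p q → uadj a₁ a₂ c p q ≡ uadj a₁ a₂ c q p
  uadj-sym a₁ a₂ c s₁ s₂ (inj₁ x) (inj₁ y) = s₁ x y
  uadj-sym a₁ a₂ c s₁ s₂ (inj₂ x) (inj₂ y) = s₂ x y
  uadj-sym a₁ a₂ c s₁ s₂ (inj₁ x) (inj₂ y) = refl
  uadj-sym a₁ a₂ c s₁ s₂ (inj₂ x) (inj₁ y) = refl

  uadj-irr : ∀ {m₁ m₂} (a₁ : Fin m₁ → Fin m₁ → Bool) (a₂ : Fin m₂ → Fin m₂ → Bool)
           (c : Fin m₁ → Fin m₂ → Bool)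
           → (∀ x → a₁ x x ≡ false) → (∀ x → a₂ x x ≡ false)
           → ∀ p → uadj a₁ a₂ c p p ≡ false
  uadj-irr a₁ a₂ c r₁ r₂ (inj₁ x) = r₁ x
  uadj-irr a₁ a₂ c r₁ r₂ (inj₂ x) = r₂ x

unionWith : (H₁ H₂ : Graph) → (Fin (n H₁) → Fin (n H₂) → Bool) → Graph
unionWith H₁ H₂ c =
  mkGraph (n H₁ Data.Nat.+ n H₂)
    (λ i j → uadj (adj H₁) (adj H₂) c (splitAt (n H₁) i) (splitAt (n H₁) j))
    (λ i j → uadj-sym (adj H₁) (adj H₂) c (adj-sym H₁) (adj-sym H₂)
               (splitAt (n H₁) i) (splitAt (n H₁) j))
    (λ i → uadj-irr (adj H₁) (adj H₂) c (adj-irr H₁) (adj-irr H₂) (splitAt (n H₁) i))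

-- The bridge operation:
--   (G₁ - v₁) ∪ (G₂ - v₂) + x₁x₂ + y₁y₂ + z₁z₂

bridge : (G₁ G₂ : Graph)
       → (v₁ x₁ y₁ z₁ : Fin (n G₁)) → (v₂ x₂ y₂ z₂ : Fin (n G₂)) → Graph
bridge G₁ G₂ v₁ x₁ y₁ z₁ v₂ x₂ y₂ z₂ = unionWith (del G₁ v₁) (del G₂ v₂) cross
  where
  cross : Fin (n (del G₁ v₁)) → Fin (n (del G₂ v₂)) → Bool
  cross a b =
    (eqb (delEmb G₁ v₁ a) x₁ ∧ eqb (delEmb G₂ v₂ b) x₂) ∨
    (eqb (delEmb G₁ v₁ a) y₁ ∧ eqb (delEmb G₂ v₂ b) y₂) ∨
    (eqb (delEmb G₁ v₁ a) z₁ ∧ eqb (delEmb G₂ v₂ b) z₂)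

NbhdIs : (G : Graph) → (v x y z : Fin (n G)) → Set
NbhdIs G v x y z =
  (x ≢ y × x ≢ z × y ≢ z) ×
  (∀ u → (Adj G v u → (u ≡ x ⊎ u ≡ y ⊎ u ≡ z)) ×
         ((u ≡ x ⊎ u ≡ y ⊎ u ≡ z) → Adj G v u))

data BridgeClosure (B : Graph → Set) : Graph → Set where
  base   : ∀ {G} → B G → BridgeClosure B G
  bridged : ∀ {G₁ G₂ v₁ x₁ y₁ z₁ v₂ x₂ y₂ z₂}
          → BridgeClosure B G₁ → BridgeClosure B G₂
          → NbhdIs G₁ v₁ x₁ y₁ z₁ → NbhdIs G₂ v₂ x₂ y₂ z₂
          → BridgeClosure B (bridge G₁ G₂ v₁ x₁ y₁ z₁ v₂ x₂ y₂ z₂)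

data Reach (G : Graph) (S : Fin (n G) → Set) : Fin (n G) → Fin (n G) → Set where
  here : ∀ {u} → S u → Reach G S u u
  step : ∀ {u w v} → S u → Adj G u w → Reach G S w v → Reach G S u v

Connected : Graph → Set
Connected G = (∀ u v → Reach G (λ _ → ⊤) u v)

HasCycle : Graph → Set
HasCycle G = Σ (Fin (n G)) λ u → Σ (List (Fin (n G))) λ xs →
  (2 ≤ length xs) × Unique (u ∷ xs) × Linked (Adj G) (u ∷ xs ++ [ u ])

IsTree : Graph → Set
IsTree T = (1 ≤ n T) × Connected T × ¬ HasCycle T

-- A tree decomposition of G of width ≤ k (bags of size ≤ k + 1;
-- a bag is given by a list enumerating it).
record TreeDecomposition (G : Graph) (k : ℕ) : Set where
  field
    tree      : Graph
    isTree    : IsTree tree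
    bag       : Fin (n tree) → List (Fin (n G))
    bag-size  : ∀ t → length (bag t) ≤ suc k
    vtx-cover : ∀ v → ∃ λ t → v ∈ bag t
    edge-cover : ∀ u v → Adj G u v → ∃ λ t → (u ∈ bag t) × (v ∈ bag t)
    connected : ∀ v t t′ → v ∈ bag t → v ∈ bag t′
              → Reach tree (λ s → v ∈ bag s) t t′

TwAtMost : Graph → ℕ → Set
TwAtMost G k = TreeDecomposition G k

-- By induction along the bridge closure, tw(L(G)) ≤ w for every G in the class; replacing
-- every edge in a bag of a decomposition of L(G) by its two ends then gives tw(G) ≤ 2w + 1.
-- For the bridge step, contracting the G₂-side of B = G₁ ⊕ G₂ to v₁ gives back G₁, and the
-- edges of G₁ correspond exactly to the edges of B touching the G₁-side; so a decomposition
-- of L(G₁) becomes a tree of bags of L(B) covering those edges, and likewise for G₂.  The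
-- three edges at v₁ pairwise share v₁, so by the Helly property of subtrees a single bag
-- contains all of them, and similarly at v₂.  The only edges of B coming from both sides are
-- the three matching edges, which lie in both of these bags; joining the two trees at these
-- bags yields a decomposition of L(B) of the same width.

module Submission where

open import Defs
open import Data.Nat using (ℕ; suc; _+_; _*_; _≤_; _<_; _<ᵇ_; z≤n; s≤s)
open import Data.Nat.Properties
  using (≤-trans; m≤m+n; <ᵇ⇒<; <⇒<ᵇ; <-cmp; <-asym; +-suc; +-identityʳ; +-comm; +-mono-≤)
open import Data.Fin using (Fin; toℕ; splitAt; punchOut; _↑ˡ_; _↑ʳ_)
  renaming (zero to fzero; suc to fsuc; _≟_ to _≟F_)
open import Data.Fin.Properties
  using (splitAt-↑ˡ; splitAt-↑ʳ; splitAt⁻¹-↑ˡ; splitAt⁻¹-↑ʳ; ↑ˡ-injective; ↑ʳ-injective; toℕ-injective;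
         punchIn-injective; punchInᵢ≢i; punchIn-punchOut; any?)
open import Data.Bool using (Bool; true; false; _∧_; _∨_; not; if_then_else_)
open import Data.Bool.Properties using (∧-comm)
open import Data.List using (List; []; _∷_; [_]; _++_; length; lookup; map; concatMap; allFin)
open import Data.List.Properties using (length-map)
open import Data.List.Membership.Propositional using (_∈_; _∉_; find)
open import Data.List.Membership.Propositional.Properties
  using (∈-concatMap⁺; ∈-concatMap⁻; ∈-allFin; ∈-lookup; ∈-map⁺; ∈-map⁻)
open import Data.List.Relation.Binary.Subset.Propositional using (_⊆_)
open import Data.List.Relation.Unary.Any using (here; there)
open import Data.List.Relation.Unary.Any.Properties using (lookup-index)
open import Data.List.Relation.Unary.All using ([]; _∷_)
open import Data.List.Relation.Unary.All.Properties using (All¬⇒¬Any; ¬Any⇒All¬)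
open import Data.List.Relation.Unary.AllPairs using ([]; _∷_)
open import Data.List.Relation.Unary.Linked using (Linked; [-]; _∷_)
open import Data.List.Relation.Unary.Unique.Propositional using (Unique)
open import Data.List.Relation.Unary.Unique.Propositional.Properties using (concat⁺; allFin⁺)
import Data.List.Relation.Unary.Any as Any
import Data.List.Relation.Unary.All as All
import Data.List.Relation.Unary.All.Properties as Allₚ
import Data.List.Relation.Unary.AllPairs as AllPairs
import Data.List.Relation.Unary.AllPairs.Properties as AllPairsₚ
open import Data.Product using (∃; ∃₂; ∃-syntax; _×_; _,_; proj₁; proj₂)
open import Data.Sum using (_⊎_; inj₁; inj₂; [_,_]′; swap)
open import Data.Unit using (tt)
open import Data.Empty using (⊥; ⊥-elim)
open import Relation.Nullary using (¬_; yes; no)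
open import Relation.Unary using (Decidable)
open import Relation.Binary.Definitions using (DecidableEquality; tri<; tri≈; tri>)
open import Relation.Binary.PropositionalEquality using (_≡_; _≢_; refl; sym; trans; cong; cong₂; subst; subst₂)
open import Relation.Binary.Construct.Closure.ReflexiveTransitive using (Star; ε; _◅_; _◅◅_; gmap; kleisliStar; reverse)

-- Walks, paths and acyclicity

data Path {V : Set} (R : V → V → Set) : V → V → List V → Set where
  end : ∀ {u} → Path R u u [ u ]
  _▹_ : ∀ {u w v vs} → R u w → Path R w v vs → Path R u v (u ∷ vs)

infixr 5 _▹_

Path-nonempty : ∀ {V : Set} {R : V → V → Set} {u v vs} → Path R u v vs → 1 ≤ length vs
Path-nonempty end     = s≤s z≤n
Path-nonempty (_ ▹ _) = s≤s z≤n

suffixPath : ∀ {V : Set} {R : V → V → Set} {w v u vs} → u ∈ vs → Path R w v vs → Unique vs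
           → ∃[ us ] Path R u v us × Unique us
suffixPath (here refl) end       un       = _ , end , un
suffixPath (here refl) (r ▹ p)   un       = _ , r ▹ p , un
suffixPath (there u∈)  (_ ▹ p)   (_ ∷ un) = suffixPath u∈ p un

module _ {V : Set} (_≟_ : DecidableEquality V) where
  open import Data.List.Membership.DecPropositional _≟_ using (_∈?_)

  walk⇒path : ∀ {R : V → V → Set} {u v} → Star R u v → ∃[ vs ] Path R u v vs × Unique vs
  walk⇒path ε = _ , end , [] ∷ []
  walk⇒path {u = u} (r ◅ walk) with walk⇒path walk
  ... | vs , p , un with u ∈? vs
  ...   | yes u∈ = suffixPath u∈ p un
  ...   | no u∉  = u ∷ vs , r ▹ p , ¬Any⇒All¬ vs u∉ ∷ un

Adj-irrefl : (G : Graph) → ∀ {i} → ¬ Adj G i i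
Adj-irrefl G {i} a with trans (sym a) (adj-irr G i)
... | ()

Adj-sym : (G : Graph) → ∀ {i j} → Adj G i j → Adj G j i
Adj-sym G {i} {j} a = trans (adj-sym G j i) a

module _ (G : Graph) where

  AdjAvoiding : (s t : Fin (n G)) → Fin (n G) → Fin (n G) → Set
  AdjAvoiding s t x y = Adj G x y × ¬ ((x ≡ s × y ≡ t) ⊎ (x ≡ t × y ≡ s))

  AdjAvoiding-swap : ∀ {s t x y} → AdjAvoiding s t x y → AdjAvoiding t s x y
  AdjAvoiding-swap (xy , avoids) =
    xy , λ { (inj₁ (p , q)) → avoids (inj₂ (p , q)) ; (inj₂ (p , q)) → avoids (inj₁ (p , q)) }

  AdjAvoiding-flip : ∀ {s t x y} → AdjAvoiding s t x y → AdjAvoiding s t y x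
  AdjAvoiding-flip (xy , avoids) =
    Adj-sym G xy , λ { (inj₁ (p , q)) → avoids (inj₂ (q , p)) ; (inj₂ (p , q)) → avoids (inj₁ (q , p)) }

  EdgesAreBridges : Set
  EdgesAreBridges = ∀ s t → Adj G s t → ¬ Star (AdjAvoiding s t) t s

  private
    linked-snoc : ∀ {s t u v x vs} → Path (AdjAvoiding s t) u v vs → Adj G v x
                → Linked (Adj G) (vs ++ [ x ])
    linked-snoc end                 a = a ∷ [-]
    linked-snoc (r ▹ end)           a = proj₁ r ∷ a ∷ [-]
    linked-snoc (r ▹ p@(_ ▹ _))     a = proj₁ r ∷ linked-snoc p a

  -- A shortest detour from t back to s avoiding the edge st closes a cycle with it.
  acyclic⇒edgesAreBridges : ¬ HasCycle G → EdgesAreBridges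
  acyclic⇒edgesAreBridges acyclic s t st walk with walk⇒path (_≟F_ {n G}) walk
  ... | _ , end , _           = Adj-irrefl G st
  ... | _ , r ▹ end , _       = proj₂ r (inj₂ (refl , refl))
  ... | _ , p@(_ ▹ _ ▹ q) , un = acyclic (t , _ , s≤s (Path-nonempty q) , un , linked-snoc p st)

  private
    detour : ∀ {u x} a ys → Linked (Adj G) (a ∷ ys ++ [ u ]) → u ∉ a ∷ ys → x ∉ ys → (ys ≡ [] → a ≢ x)
           → Star (AdjAvoiding u x) a u
    detour a [] (au ∷ [-]) u∉ _ a≢x =
      (au , λ { (inj₁ (a≡u , _)) → u∉ (here (sym a≡u)) ; (inj₂ (a≡x , _)) → a≢x refl a≡x }) ◅ ε
    detour a (y ∷ ys) (ay ∷ lk) u∉ x∉ _ =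
      (ay , λ { (inj₁ (a≡u , _)) → u∉ (here (sym a≡u)) ; (inj₂ (_ , y≡u)) → u∉ (there (here (sym y≡u))) })
      ◅ detour y ys lk (λ m → u∉ (there m)) (λ m → x∉ (there m)) (λ _ y≡x → x∉ (here (sym y≡x)))

  edgesAreBridges⇒acyclic : EdgesAreBridges → ¬ HasCycle G
  edgesAreBridges⇒acyclic bridges (_ , _ ∷ [] , s≤s () , _)
  edgesAreBridges⇒acyclic bridges (u , x ∷ r ∷ rest , _ , (u∉ ∷ x∉ ∷ _) , (ux ∷ lk)) =
    bridges u x ux (detour x (r ∷ rest) lk (All¬⇒¬Any u∉) (All¬⇒¬Any x∉) (λ ()))

module _ {G : Graph} {S : Fin (n G) → Set} where

  Reach-head : ∀ {u v} → Reach G S u v → S u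
  Reach-head (here s)     = s
  Reach-head (step s _ _) = s

  infixr 5 _⁀_

  _⁀_ : ∀ {u v w} → Reach G S u v → Reach G S v w → Reach G S u w
  here _     ⁀ q = q
  step s a p ⁀ q = step s a (p ⁀ q)

  Reach-snoc : ∀ {u v w} → Reach G S u v → Adj G v w → S w → Reach G S u w
  Reach-snoc (here s)     vw sw = step s vw (here sw)
  Reach-snoc (step s a p) vw sw = step s a (Reach-snoc p vw sw)

Reach-map : ∀ {G₁ G₂} {S₁ : Fin (n G₁) → Set} {S₂ : Fin (n G₂) → Set} (f : Fin (n G₁) → Fin (n G₂))
          → (∀ {x y} → Adj G₁ x y → Adj G₂ (f x) (f y)) → (∀ {x} → S₁ x → S₂ (f x))
          → ∀ {u v} → Reach G₁ S₁ u v → Reach G₂ S₂ (f u) (f v)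
Reach-map f f-adj f-S (here s)     = here (f-S s)
Reach-map f f-adj f-S (step s a p) = step (f-S s) (f-adj a) (Reach-map f f-adj f-S p)

Reach-mono : ∀ {G} {S S′ : Fin (n G) → Set} → (∀ {x} → S x → S′ x)
           → ∀ {u v} → Reach G S u v → Reach G S′ u v
Reach-mono = Reach-map (λ x → x) (λ a → a)

-- Disjoint unions, and joining two trees by an edge

data View (m k : ℕ) (i : Fin (m + k)) : Set where
  left  : (a : Fin m) → i ≡ a ↑ˡ k → View m k i
  right : (b : Fin k) → i ≡ m ↑ʳ b → View m k i

view : ∀ m k (i : Fin (m + k)) → View m k i
view m k i with splitAt m i in eq
... | inj₁ a = left a (sym (splitAt⁻¹-↑ˡ eq))
... | inj₂ b = right b (sym (splitAt⁻¹-↑ʳ eq))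

split : ∀ m k (i : Fin (m + k)) → (∃ λ a → i ≡ a ↑ˡ k) ⊎ (∃ λ b → i ≡ m ↑ʳ b)
split m k i with view m k i
... | left a i≡  = inj₁ (a , i≡)
... | right b i≡ = inj₂ (b , i≡)

↑ˡ≢↑ʳ : ∀ {m k} {a : Fin m} {b : Fin k} → a ↑ˡ k ≢ m ↑ʳ b
↑ˡ≢↑ʳ {m} {k} {a} {b} eq with trans (sym (splitAt-↑ˡ m a k)) (trans (cong (splitAt m) eq) (splitAt-↑ʳ m k b))
... | ()

module _ {A : Set} {m k : ℕ} (f : Fin m → A) (g : Fin k → A) where

  caseSplit : Fin (m + k) → A
  caseSplit i = [ f , g ]′ (splitAt m i)

  caseSplit-↑ˡ : ∀ a → caseSplit (a ↑ˡ k) ≡ f a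
  caseSplit-↑ˡ a rewrite splitAt-↑ˡ m a k = refl

  caseSplit-↑ʳ : ∀ b → caseSplit (m ↑ʳ b) ≡ g b
  caseSplit-↑ʳ b rewrite splitAt-↑ʳ m k b = refl

module Union (H₁ H₂ : Graph) (c : Fin (n H₁) → Fin (n H₂) → Bool) where
  private
    n₁ = n H₁
    n₂ = n H₂
    H  = unionWith H₁ H₂ c

  adj-↑ˡ↑ˡ : ∀ a b → adj H (a ↑ˡ n₂) (b ↑ˡ n₂) ≡ adj H₁ a b
  adj-↑ˡ↑ˡ a b rewrite splitAt-↑ˡ n₁ a n₂ | splitAt-↑ˡ n₁ b n₂ = refl

  adj-↑ˡ↑ʳ : ∀ a b → adj H (a ↑ˡ n₂) (n₁ ↑ʳ b) ≡ c a b
  adj-↑ˡ↑ʳ a b rewrite splitAt-↑ˡ n₁ a n₂ | splitAt-↑ʳ n₁ n₂ b = refl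

  adj-↑ʳ↑ˡ : ∀ a b → adj H (n₁ ↑ʳ b) (a ↑ˡ n₂) ≡ c a b
  adj-↑ʳ↑ˡ a b rewrite splitAt-↑ˡ n₁ a n₂ | splitAt-↑ʳ n₁ n₂ b = refl

  adj-↑ʳ↑ʳ : ∀ a b → adj H (n₁ ↑ʳ a) (n₁ ↑ʳ b) ≡ adj H₂ a b
  adj-↑ʳ↑ʳ a b rewrite splitAt-↑ʳ n₁ n₂ a | splitAt-↑ʳ n₁ n₂ b = refl

eqb⇒≡ : ∀ {m} {a b : Fin m} → eqb a b ≡ true → a ≡ b
eqb⇒≡ {a = a} {b} e with a ≟F b
... | yes a≡b = a≡b
eqb⇒≡ () | no _

∧⇒× : ∀ {p q} → p ∧ q ≡ true → p ≡ true × q ≡ true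
∧⇒× {true} q≡true = refl , q≡true

Star-≡ : ∀ {V : Set} {R : V → V → Set} {x y} → x ≡ y → Star R x y
Star-≡ refl = ε

singleton : Graph
singleton = mkGraph 1 (λ _ _ → false) (λ _ _ → refl) (λ _ → refl)

singleton-isTree : IsTree singleton
singleton-isTree =
  s≤s z≤n , (λ { fzero fzero → here tt }) , λ { (fzero , fzero ∷ _ , _ , ((u≢x ∷ _) ∷ _) , _) → u≢x refl }

edgeBetween : ∀ {m k} → Fin m → Fin k → Fin m → Fin k → Bool
edgeBetween a b x y = eqb x a ∧ eqb y b

edgeBetween⇒≡ : ∀ {m k} {a x : Fin m} {b y : Fin k} → edgeBetween a b x y ≡ true → x ≡ a × y ≡ b
edgeBetween⇒≡ e with ∧⇒× e
... | x≡a , y≡b = eqb⇒≡ x≡a , eqb⇒≡ y≡b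

joinAt : (T₁ T₂ : Graph) → Fin (n T₁) → Fin (n T₂) → Graph
joinAt T₁ T₂ a b = unionWith T₁ T₂ (edgeBetween a b)

module JoinAt (T₁ T₂ : Graph) (a : Fin (n T₁)) (b : Fin (n T₂)) where
  open Union T₁ T₂ (edgeBetween a b)
  private
    n₁ = n T₁
    n₂ = n T₂
    T  = joinAt T₁ T₂ a b

  ↑ˡ-adj : ∀ {x y} → Adj T₁ x y → Adj T (x ↑ˡ n₂) (y ↑ˡ n₂)
  ↑ˡ-adj {x} {y} xy = trans (adj-↑ˡ↑ˡ x y) xy

  ↑ʳ-adj : ∀ {x y} → Adj T₂ x y → Adj T (n₁ ↑ʳ x) (n₁ ↑ʳ y)
  ↑ʳ-adj {x} {y} xy = trans (adj-↑ʳ↑ʳ x y) xy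

  join-adj : Adj T (a ↑ˡ n₂) (n₁ ↑ʳ b)
  join-adj = trans (adj-↑ˡ↑ʳ a b) (trans (cong (_∧ eqb b b) (eqb-refl a)) (eqb-refl b))

  join-adj′ : Adj T (n₁ ↑ʳ b) (a ↑ˡ n₂)
  join-adj′ = Adj-sym T join-adj

  join-ends : ∀ {x y} → Adj T (x ↑ˡ n₂) (n₁ ↑ʳ y) → x ≡ a × y ≡ b
  join-ends {x} {y} xy = edgeBetween⇒≡ {a = a} {x} {b} {y} (trans (sym (adj-↑ˡ↑ʳ x y)) xy)

  join-ends′ : ∀ {x y} → Adj T (n₁ ↑ʳ y) (x ↑ˡ n₂) → x ≡ a × y ≡ b
  join-ends′ yx = join-ends (Adj-sym T yx)

  reachˡ : ∀ {S₁ S} → (∀ {x} → S₁ x → S (x ↑ˡ n₂))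
         → ∀ {u v} → Reach T₁ S₁ u v → Reach T S (u ↑ˡ n₂) (v ↑ˡ n₂)
  reachˡ = Reach-map (_↑ˡ n₂) ↑ˡ-adj

  reachʳ : ∀ {S₂ S} → (∀ {x} → S₂ x → S (n₁ ↑ʳ x))
         → ∀ {u v} → Reach T₂ S₂ u v → Reach T S (n₁ ↑ʳ u) (n₁ ↑ʳ v)
  reachʳ = Reach-map (n₁ ↑ʳ_) ↑ʳ-adj

  connected : Connected T₁ → Connected T₂ → Connected T
  connected c₁ c₂ i j with view n₁ n₂ i | view n₁ n₂ j
  ... | left x refl  | left y refl  = reachˡ _ (c₁ x y)
  ... | right x refl | right y refl = reachʳ _ (c₂ x y)
  ... | left x refl  | right y refl = reachˡ _ (c₁ x a) ⁀ step tt join-adj (reachʳ _ (c₂ b y))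
  ... | right x refl | left y refl  = reachʳ _ (c₂ x b) ⁀ step tt join-adj′ (reachˡ _ (c₁ a y))

  private
    projˡ : Fin (n₁ + n₂) → Fin n₁
    projˡ = caseSplit {m = n₁} {k = n₂} (λ x → x) (λ _ → a)

    projʳ : Fin (n₁ + n₂) → Fin n₂
    projʳ = caseSplit {m = n₁} {k = n₂} (λ _ → b) (λ x → x)

    onLeft : Fin (n₁ + n₂) → Bool
    onLeft = caseSplit {m = n₁} {k = n₂} (λ _ → true) (λ _ → false)

    onLeft-↑ˡ : ∀ x → onLeft (x ↑ˡ n₂) ≡ true
    onLeft-↑ˡ = caseSplit-↑ˡ {m = n₁} {k = n₂} (λ _ → true) (λ _ → false)
    onLeft-↑ʳ : ∀ x → onLeft (n₁ ↑ʳ x) ≡ false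
    onLeft-↑ʳ = caseSplit-↑ʳ {m = n₁} {k = n₂} (λ _ → true) (λ _ → false)

    projˡ-↑ˡ : ∀ x → projˡ (x ↑ˡ n₂) ≡ x
    projˡ-↑ˡ = caseSplit-↑ˡ {m = n₁} {k = n₂} (λ x → x) (λ _ → a)
    projˡ-↑ʳ : ∀ x → projˡ (n₁ ↑ʳ x) ≡ a
    projˡ-↑ʳ = caseSplit-↑ʳ {m = n₁} {k = n₂} (λ x → x) (λ _ → a)
    projʳ-↑ˡ : ∀ x → projʳ (x ↑ˡ n₂) ≡ b
    projʳ-↑ˡ = caseSplit-↑ˡ {m = n₁} {k = n₂} (λ _ → b) (λ x → x)
    projʳ-↑ʳ : ∀ x → projʳ (n₁ ↑ʳ x) ≡ x
    projʳ-↑ʳ = caseSplit-↑ʳ {m = n₁} {k = n₂} (λ _ → b) (λ x → x)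

    -- Collapsing T₂ onto a turns a detour in T into a detour in T₁.
    projˡ-avoiding : ∀ {σ τ x y} → AdjAvoiding T (σ ↑ˡ n₂) (τ ↑ˡ n₂) x y
                   → Star (AdjAvoiding T₁ σ τ) (projˡ x) (projˡ y)
    projˡ-avoiding {x = x} {y} (xy , avoids) with view n₁ n₂ x | view n₁ n₂ y
    ... | left x′ refl | left y′ refl rewrite projˡ-↑ˡ x′ | projˡ-↑ˡ y′ =
      (trans (sym (adj-↑ˡ↑ˡ x′ y′)) xy ,
       λ { (inj₁ (p , q)) → avoids (inj₁ (cong (_↑ˡ n₂) p , cong (_↑ˡ n₂) q))
         ; (inj₂ (p , q)) → avoids (inj₂ (cong (_↑ˡ n₂) p , cong (_↑ˡ n₂) q)) }) ◅ ε
    ... | left x′ refl | right y′ refl rewrite projˡ-↑ˡ x′ | projˡ-↑ʳ y′ =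
      Star-≡ (proj₁ (join-ends xy))
    ... | right x′ refl | left y′ refl rewrite projˡ-↑ʳ x′ | projˡ-↑ˡ y′ =
      Star-≡ (sym (proj₁ (join-ends′ xy)))
    ... | right x′ refl | right y′ refl rewrite projˡ-↑ʳ x′ | projˡ-↑ʳ y′ = ε

    projʳ-avoiding : ∀ {σ τ x y} → AdjAvoiding T (n₁ ↑ʳ σ) (n₁ ↑ʳ τ) x y
                   → Star (AdjAvoiding T₂ σ τ) (projʳ x) (projʳ y)
    projʳ-avoiding {x = x} {y} (xy , avoids) with view n₁ n₂ x | view n₁ n₂ y
    ... | right x′ refl | right y′ refl rewrite projʳ-↑ʳ x′ | projʳ-↑ʳ y′ =
      (trans (sym (adj-↑ʳ↑ʳ x′ y′)) xy ,
       λ { (inj₁ (p , q)) → avoids (inj₁ (cong (n₁ ↑ʳ_) p , cong (n₁ ↑ʳ_) q))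
         ; (inj₂ (p , q)) → avoids (inj₂ (cong (n₁ ↑ʳ_) p , cong (n₁ ↑ʳ_) q)) }) ◅ ε
    ... | left x′ refl | right y′ refl rewrite projʳ-↑ˡ x′ | projʳ-↑ʳ y′ =
      Star-≡ (sym (proj₂ (join-ends xy)))
    ... | right x′ refl | left y′ refl rewrite projʳ-↑ʳ x′ | projʳ-↑ˡ y′ =
      Star-≡ (proj₂ (join-ends′ xy))
    ... | left x′ refl | left y′ refl rewrite projʳ-↑ˡ x′ | projʳ-↑ˡ y′ = ε

    avoiding-join-stays : ∀ {x y} → AdjAvoiding T (a ↑ˡ n₂) (n₁ ↑ʳ b) x y → onLeft x ≡ onLeft y
    avoiding-join-stays {x} {y} (xy , avoids) with view n₁ n₂ x | view n₁ n₂ y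
    ... | left x′ refl  | left y′ refl  = trans (onLeft-↑ˡ x′) (sym (onLeft-↑ˡ y′))
    ... | right x′ refl | right y′ refl = trans (onLeft-↑ʳ x′) (sym (onLeft-↑ʳ y′))
    ... | left x′ refl  | right y′ refl with join-ends xy
    ...   | refl , refl = ⊥-elim (avoids (inj₁ (refl , refl)))
    avoiding-join-stays (xy , avoids) | right x′ refl | left y′ refl
      with join-ends′ xy
    ...   | refl , refl = ⊥-elim (avoids (inj₂ (refl , refl)))

    walk-avoiding-join-stays : ∀ {x y} → Star (AdjAvoiding T (a ↑ˡ n₂) (n₁ ↑ʳ b)) x y → onLeft x ≡ onLeft y
    walk-avoiding-join-stays ε           = refl
    walk-avoiding-join-stays (xy ◅ walk) = trans (avoiding-join-stays xy) (walk-avoiding-join-stays walk)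

    crosses-join : ∀ {x y} → Star (AdjAvoiding T (a ↑ˡ n₂) (n₁ ↑ʳ b)) (n₁ ↑ʳ y) (x ↑ˡ n₂) → ⊥
    crosses-join {x} {y} walk
      with trans (sym (onLeft-↑ʳ y)) (trans (walk-avoiding-join-stays walk) (onLeft-↑ˡ x))
    ... | ()

  edgesAreBridges : EdgesAreBridges T₁ → EdgesAreBridges T₂ → EdgesAreBridges T
  edgesAreBridges br₁ br₂ s t st walk with view n₁ n₂ s | view n₁ n₂ t
  ... | left σ refl | left τ refl =
    br₁ σ τ (trans (sym (adj-↑ˡ↑ˡ σ τ)) st)
      (subst₂ (Star _) (projˡ-↑ˡ τ) (projˡ-↑ˡ σ) (kleisliStar projˡ (projˡ-avoiding {σ} {τ}) walk))
  ... | right σ refl | right τ refl =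
    br₂ σ τ (trans (sym (adj-↑ʳ↑ʳ σ τ)) st)
      (subst₂ (Star _) (projʳ-↑ʳ τ) (projʳ-↑ʳ σ) (kleisliStar projʳ (projʳ-avoiding {σ} {τ}) walk))
  ... | left σ refl | right τ refl with join-ends st
  ...   | refl , refl = crosses-join walk
  edgesAreBridges br₁ br₂ s t st walk | right σ refl | left τ refl
    with join-ends′ st
  ...   | refl , refl = crosses-join (gmap (λ x → x) (AdjAvoiding-swap T) (reverse (AdjAvoiding-flip T) walk))

  isTree : IsTree T₁ → IsTree T₂ → IsTree T
  isTree (nonempty₁ , connected₁ , acyclic₁) (_ , connected₂ , acyclic₂) =
    ≤-trans nonempty₁ (m≤m+n n₁ n₂) ,
    connected connected₁ connected₂ ,
    edgesAreBridges⇒acyclic T (edgesAreBridges (acyclic⇒edgesAreBridges T₁ acyclic₁)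
                                               (acyclic⇒edgesAreBridges T₂ acyclic₂))

-- The Helly property for three subtrees

ConnectedIn : (T : Graph) → (Fin (n T) → Set) → Set
ConnectedIn T S = ∀ x y → S x → S y → Reach T S x y

Reach⇒avoiding : ∀ {G} {S : Fin (n G) → Set} {s t x y} → (∀ {z} → S z → z ≢ s) → Reach G S x y
               → Star (AdjAvoiding G s t) x y
Reach⇒avoiding S∌s (here _) = ε
Reach⇒avoiding S∌s (step sx xw walk) =
  (xw , λ { (inj₁ (x≡s , _)) → S∌s sx x≡s ; (inj₂ (_ , w≡s)) → S∌s (Reach-head walk) w≡s })
  ◅ Reach⇒avoiding S∌s walk

module Helly (T : Graph) (bridges : EdgesAreBridges T) {U V W : Fin (n T) → Set}
  (U? : Decidable U) (V? : Decidable V) (cU : ConnectedIn T U) (cV : ConnectedIn T V) (cW : ConnectedIn T W) where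

  private
    data Search (p : Fin (n T)) : Set where
      found : ∃[ t ] U t × V t × W t → Search p
      exit  : ∀ c c′ → Adj T c c′ → ¬ V c → V c′ → ¬ U c′ → Reach T (λ z → ¬ V z) p c → Search p

    search : ∀ {p c q} → ¬ V c → Reach T (λ z → ¬ V z) p c → Reach T W c q → V q → Search p
    search c∉V _ (here _) q∈V = ⊥-elim (c∉V q∈V)
    search {c = c} c∉V p→c (step _ cc′ rest) q∈V with V? _ | U? _
    ... | yes c′∈V | yes c′∈U = found (_ , c′∈U , c′∈V , Reach-head rest)
    ... | yes c′∈V | no  c′∉U = exit c _ cc′ c∉V c′∈V c′∉U p→c
    ... | no  c′∉V | _        = search c′∉V (Reach-snoc p→c cc′ c′∉V) rest q∈V

  helly : ∀ {p q r} → W p → U p → W q → V q → U r → V r → ∃[ t ] U t × V t × W t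
  helly {p} {q} {r} p∈W p∈U q∈W q∈V r∈U r∈V with V? p
  ... | yes p∈V = p , p∈U , p∈V , p∈W
  ... | no  p∉V with search p∉V (here p∉V) (cW p q p∈W q∈W) q∈V
  ...   | found t = t
  -- c′ → r inside V, r → p inside U, p → c outside V: a detour around the edge cc′
  ...   | exit c c′ cc′ c∉V c′∈V c′∉U p→c =
    ⊥-elim (bridges c c′ cc′
      (Reach⇒avoiding (λ z∈V z≡c → c∉V (subst V z≡c z∈V)) (cV c′ r c′∈V r∈V)
       ◅◅ gmap (λ x → x) (AdjAvoiding-swap T)
            (Reach⇒avoiding (λ z∈U z≡c′ → c′∉U (subst U z≡c′ z∈U)) (cU r p r∈U p∈U)
             ◅◅ Reach⇒avoiding (λ z∉V z≡c′ → z∉V (subst V (sym z≡c′) c′∈V)) p→c)))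

-- Trees of bags

record BagTree (G : Graph) (k : ℕ) : Set where
  field
    tree      : Graph
    isTree    : IsTree tree
    bag       : Fin (n tree) → List (Fin (n G))
    bag-size  : ∀ t → length (bag t) ≤ suc k
    connected : ∀ v t t′ → v ∈ bag t → v ∈ bag t′ → Reach tree (λ s → v ∈ bag s) t t′

module _ {G : Graph} {k : ℕ} where
  open BagTree

  _⊑_ : BagTree G k → BagTree G k → Set
  P ⊑ Q = ∀ t → ∃ λ t′ → bag P t ⊆ bag Q t′

  ⊑-refl : ∀ {P : BagTree G k} → P ⊑ P
  ⊑-refl t = t , λ v∈ → v∈

  ⊑-trans : ∀ {P Q R : BagTree G k} → P ⊑ Q → Q ⊑ R → P ⊑ R
  ⊑-trans P⊑Q Q⊑R t with P⊑Q t
  ... | t′ , ⊆₁ with Q⊑R t′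
  ...   | t″ , ⊆₂ = t″ , λ v∈ → ⊆₂ (⊆₁ v∈)

  VerticesCovered : BagTree G k → Set
  VerticesCovered P = ∀ v → ∃ λ t → v ∈ bag P t

  EdgesCovered : BagTree G k → Set
  EdgesCovered P = ∀ u v → Adj G u v → ∃ λ t → u ∈ bag P t × v ∈ bag P t

  EdgesCovered-⊑ : ∀ {P Q : BagTree G k} → P ⊑ Q → EdgesCovered P → EdgesCovered Q
  EdgesCovered-⊑ P⊑Q covered u v uv with covered u v uv
  ... | t , u∈ , v∈ with P⊑Q t
  ...   | t′ , ⊆ = t′ , ⊆ u∈ , ⊆ v∈

  module JoinBagTrees (P₁ P₂ : BagTree G k) (t₁ : Fin (n (tree P₁))) (t₂ : Fin (n (tree P₂)))
    (shared : ∀ v s s′ → v ∈ bag P₁ s → v ∈ bag P₂ s′ → v ∈ bag P₁ t₁ × v ∈ bag P₂ t₂) where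
    open JoinAt (tree P₁) (tree P₂) t₁ t₂ using (reachˡ; reachʳ; join-adj; join-adj′)
      renaming (isTree to joinAt-isTree)
    private
      n₁ = n (tree P₁)
      n₂ = n (tree P₂)

      jbag : Fin (n₁ + n₂) → List (Fin (n G))
      jbag = caseSplit (bag P₁) (bag P₂)

      ↑ˡ-∈ : ∀ {v x} → v ∈ bag P₁ x → v ∈ jbag (x ↑ˡ n₂)
      ↑ˡ-∈ {v} {x} = subst (v ∈_) (sym (caseSplit-↑ˡ (bag P₁) (bag P₂) x))
      ↑ˡ-∈⁻ : ∀ {v x} → v ∈ jbag (x ↑ˡ n₂) → v ∈ bag P₁ x
      ↑ˡ-∈⁻ {v} {x} = subst (v ∈_) (caseSplit-↑ˡ (bag P₁) (bag P₂) x)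
      ↑ʳ-∈ : ∀ {v x} → v ∈ bag P₂ x → v ∈ jbag (n₁ ↑ʳ x)
      ↑ʳ-∈ {v} {x} = subst (v ∈_) (sym (caseSplit-↑ʳ (bag P₁) (bag P₂) x))
      ↑ʳ-∈⁻ : ∀ {v x} → v ∈ jbag (n₁ ↑ʳ x) → v ∈ bag P₂ x
      ↑ʳ-∈⁻ {v} {x} = subst (v ∈_) (caseSplit-↑ʳ (bag P₁) (bag P₂) x)

      jbag-size : ∀ i → length (jbag i) ≤ suc k
      jbag-size i with view n₁ n₂ i
      ... | left x refl  = subst (λ b → length b ≤ suc k) (sym (caseSplit-↑ˡ (bag P₁) (bag P₂) x)) (bag-size P₁ x)
      ... | right x refl = subst (λ b → length b ≤ suc k) (sym (caseSplit-↑ʳ (bag P₁) (bag P₂) x)) (bag-size P₂ x)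

      jconnected : ∀ v i j → v ∈ jbag i → v ∈ jbag j
                 → Reach (joinAt (tree P₁) (tree P₂) t₁ t₂) (λ s → v ∈ jbag s) i j
      jconnected v i j v∈i v∈j with view n₁ n₂ i | view n₁ n₂ j
      ... | left x refl  | left y refl  = reachˡ ↑ˡ-∈ (connected P₁ v x y (↑ˡ-∈⁻ v∈i) (↑ˡ-∈⁻ v∈j))
      ... | right x refl | right y refl = reachʳ ↑ʳ-∈ (connected P₂ v x y (↑ʳ-∈⁻ v∈i) (↑ʳ-∈⁻ v∈j))
      ... | left x refl  | right y refl with shared v x y (↑ˡ-∈⁻ v∈i) (↑ʳ-∈⁻ v∈j)
      ...   | v∈t₁ , v∈t₂ =
        reachˡ ↑ˡ-∈ (connected P₁ v x t₁ (↑ˡ-∈⁻ v∈i) v∈t₁)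
        ⁀ step (↑ˡ-∈ v∈t₁) join-adj (reachʳ ↑ʳ-∈ (connected P₂ v t₂ y v∈t₂ (↑ʳ-∈⁻ v∈j)))
      jconnected v i j v∈i v∈j | right x refl | left y refl with shared v y x (↑ˡ-∈⁻ v∈j) (↑ʳ-∈⁻ v∈i)
      ...   | v∈t₁ , v∈t₂ =
        reachʳ ↑ʳ-∈ (connected P₂ v x t₂ (↑ʳ-∈⁻ v∈i) v∈t₂)
        ⁀ step (↑ʳ-∈ v∈t₂) join-adj′ (reachˡ ↑ˡ-∈ (connected P₁ v t₁ y v∈t₁ (↑ˡ-∈⁻ v∈j)))

    joined : BagTree G k
    joined = record
      { tree      = joinAt (tree P₁) (tree P₂) t₁ t₂
      ; isTree    = joinAt-isTree (isTree P₁) (isTree P₂)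
      ; bag       = jbag
      ; bag-size  = jbag-size
      ; connected = jconnected
      }

    ⊑-joinedˡ : P₁ ⊑ joined
    ⊑-joinedˡ t = t ↑ˡ n₂ , ↑ˡ-∈

    ⊑-joinedʳ : P₂ ⊑ joined
    ⊑-joinedʳ t = n₁ ↑ʳ t , ↑ʳ-∈

  leaf : Fin (n G) → BagTree G k
  leaf v = record
    { tree      = singleton
    ; isTree    = singleton-isTree
    ; bag       = λ _ → [ v ]
    ; bag-size  = λ _ → s≤s z≤n
    ; connected = λ { _ fzero fzero v∈ _ → here v∈ }
    }

  some-node : (P : BagTree G k) → Fin (n (tree P))
  some-node P with proj₁ (isTree P)
  ... | s≤s _ = fzero

  addLeaf : (P : BagTree G k) (v : Fin (n G)) → (∀ t → v ∉ bag P t)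
          → ∃ λ P′ → P ⊑ P′ × ∃ λ t → v ∈ bag P′ t
  addLeaf P v v∉P = joined , ⊑-joinedˡ , proj₁ (⊑-joinedʳ fzero) , proj₂ (⊑-joinedʳ fzero) (here refl)
    where
    shared : ∀ u s s′ → u ∈ bag P s → u ∈ bag (leaf v) s′ → u ∈ bag P (some-node P) × u ∈ [ v ]
    shared u s _ u∈ (here refl) = ⊥-elim (v∉P s u∈)
    open JoinBagTrees P (leaf v) (some-node P) fzero shared

  private
    open import Data.List.Membership.DecPropositional (_≟F_ {n G}) using (_∈?_)

    coverAll : (vs : List (Fin (n G))) (P : BagTree G k)
             → ∃ λ P′ → P ⊑ P′ × ∀ v → v ∈ vs → ∃ λ t → v ∈ bag P′ t
    coverAll [] P = P , ⊑-refl {P = P} , λ _ ()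
    coverAll (v ∷ vs) P with coverAll vs P
    ... | P₁ , P⊑P₁ , covers with any? (λ t → v ∈? bag P₁ t)
    ...   | yes v∈P₁ = P₁ , P⊑P₁ , λ { u (here refl) → v∈P₁ ; u (there u∈) → covers u u∈ }
    ...   | no  v∉P₁ with addLeaf P₁ v (λ t v∈ → v∉P₁ (t , v∈))
    ...     | P₂ , P₁⊑P₂ , v∈P₂ = P₂ , ⊑-trans {P = P} {Q = P₁} {R = P₂} P⊑P₁ P₁⊑P₂ ,
      λ { u (here refl) → v∈P₂
        ; u (there u∈) → let (t , u∈t) = covers u u∈ ; (t′ , ⊆) = P₁⊑P₂ t in t′ , ⊆ u∈t }

  coverVertices : (P : BagTree G k) → ∃ λ P′ → P ⊑ P′ × VerticesCovered P′
  coverVertices P with coverAll (allFin (n G)) P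
  ... | P′ , P⊑P′ , covers = P′ , P⊑P′ , λ v → covers v (∈-allFin v)

  toTreeDecomposition : (P : BagTree G k) → EdgesCovered P → TwAtMost G k
  toTreeDecomposition P edges-covered with coverVertices P
  ... | P′ , P⊑P′ , vertices-covered = record
    { tree       = tree P′
    ; isTree     = isTree P′
    ; bag        = bag P′
    ; bag-size   = bag-size P′
    ; vtx-cover  = vertices-covered
    ; edge-cover = EdgesCovered-⊑ {P = P} {Q = P′} P⊑P′ edges-covered
    ; connected  = connected P′
    }

-- Edges and the line graph

∨⇒⊎ : ∀ {p q} → p ∨ q ≡ true → p ≡ true ⊎ q ≡ true
∨⇒⊎ {true}  _ = inj₁ refl
∨⇒⊎ {false} q = inj₂ q

∨-introˡ : ∀ {p} q → p ≡ true → p ∨ q ≡ true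
∨-introˡ _ refl = refl

∨-introʳ : ∀ p {q} → q ≡ true → p ∨ q ≡ true
∨-introʳ true  _ = refl
∨-introʳ false q = q

≢⇒eqb : ∀ {m} {a b : Fin m} → a ≢ b → eqb a b ≡ false
≢⇒eqb {a = a} {b} a≢b with a ≟F b
... | yes a≡b = ⊥-elim (a≢b a≡b)
... | no  _   = refl

not-eqb⇒≢ : ∀ {m} {a b : Fin m} → not (eqb a b) ≡ true → a ≢ b
not-eqb⇒≢ {a = a} {b} ne a≡b with a ≟F b
not-eqb⇒≢ () _ | yes _
... | no a≢b = a≢b a≡b

∈-if⁻ : ∀ {A : Set} b {x y : A} → x ∈ (if b then [ y ] else []) → b ≡ true × x ≡ y
∈-if⁻ true (here x≡y) = refl , x≡y

∈-if⁺ : ∀ {A : Set} {b} {y : A} → b ≡ true → y ∈ (if b then [ y ] else [])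
∈-if⁺ refl = here refl

concatMap-unique : ∀ {A B : Set} (f : A → List B) {xs} → Unique xs → (∀ x → Unique (f x))
                 → (∀ {x x′ y} → y ∈ f x → y ∈ f x′ → x ≡ x′) → Unique (concatMap f xs)
concatMap-unique f unique-xs unique-f disjoint =
  concat⁺ (Allₚ.map⁺ (All.tabulate (λ {x} _ → unique-f x)))
          (AllPairsₚ.map⁺ (AllPairs.map (λ x≢x′ {y} (y∈ , y∈′) → x≢x′ (disjoint y∈ y∈′)) unique-xs))

lookup-injective : ∀ {A : Set} {xs : List A} → Unique xs → ∀ k l → lookup xs k ≡ lookup xs l → k ≡ l
lookup-injective {xs = _ ∷ _}  _          fzero    fzero    _  = refl
lookup-injective {xs = _ ∷ xs} (x∉xs ∷ _) fzero    (fsuc l) eq =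
  ⊥-elim (All¬⇒¬Any x∉xs (subst (_∈ xs) (sym eq) (∈-lookup l)))
lookup-injective {xs = _ ∷ xs} (x∉xs ∷ _) (fsuc k) fzero    eq =
  ⊥-elim (All¬⇒¬Any x∉xs (subst (_∈ xs) eq (∈-lookup k)))
lookup-injective {xs = _ ∷ _}  (_ ∷ un)   (fsuc k) (fsuc l) eq = cong fsuc (lookup-injective un k l eq)

module _ {m : ℕ} where

  IsEnd : Fin m → Fin m × Fin m → Set
  IsEnd v (a , b) = v ≡ a ⊎ v ≡ b

  SameEdge : Fin m × Fin m → Fin m × Fin m → Set
  SameEdge (a , b) (c , d) = (a ≡ c × b ≡ d) ⊎ (a ≡ d × b ≡ c)

  SameEdge-sym : ∀ {p q} → SameEdge p q → SameEdge q p
  SameEdge-sym (inj₁ (a≡c , b≡d)) = inj₁ (sym a≡c , sym b≡d)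
  SameEdge-sym (inj₂ (a≡d , b≡c)) = inj₂ (sym b≡c , sym a≡d)

  SameEdge-trans : ∀ {p q r} → SameEdge p q → SameEdge q r → SameEdge p r
  SameEdge-trans (inj₁ (a , b)) (inj₁ (c , d)) = inj₁ (trans a c , trans b d)
  SameEdge-trans (inj₁ (a , b)) (inj₂ (c , d)) = inj₂ (trans a c , trans b d)
  SameEdge-trans (inj₂ (a , b)) (inj₁ (c , d)) = inj₂ (trans a d , trans b c)
  SameEdge-trans (inj₂ (a , b)) (inj₂ (c , d)) = inj₁ (trans a d , trans b c)

  IsEnd-SameEdge : ∀ {v p q} → IsEnd v p → SameEdge p q → IsEnd v q
  IsEnd-SameEdge (inj₁ v≡a) (inj₁ (a≡c , _)) = inj₁ (trans v≡a a≡c)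
  IsEnd-SameEdge (inj₂ v≡b) (inj₁ (_ , b≡d)) = inj₂ (trans v≡b b≡d)
  IsEnd-SameEdge (inj₁ v≡a) (inj₂ (a≡d , _)) = inj₂ (trans v≡a a≡d)
  IsEnd-SameEdge (inj₂ v≡b) (inj₂ (_ , b≡c)) = inj₁ (trans v≡b b≡c)

  share⇒IsEnd : ∀ p q → share p q ≡ true → ∃ λ v → IsEnd v p × IsEnd v q
  share⇒IsEnd (a , b) (c , d) eq with ∨⇒⊎ {eqb a c} eq
  ... | inj₁ a≡c = a , inj₁ refl , inj₁ (eqb⇒≡ a≡c)
  ... | inj₂ eq′ with ∨⇒⊎ {eqb a d} eq′
  ...   | inj₁ a≡d = a , inj₁ refl , inj₂ (eqb⇒≡ a≡d)
  ...   | inj₂ eq″ with ∨⇒⊎ {eqb b c} eq″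
  ...     | inj₁ b≡c = b , inj₂ refl , inj₁ (eqb⇒≡ b≡c)
  ...     | inj₂ b≡d = b , inj₂ refl , inj₂ (eqb⇒≡ b≡d)

  IsEnd⇒share : ∀ p q v → IsEnd v p → IsEnd v q → share p q ≡ true
  IsEnd⇒share (a , b) (c , d) v (inj₁ refl) (inj₁ refl) = ∨-introˡ _ (eqb-refl v)
  IsEnd⇒share (a , b) (c , d) v (inj₁ refl) (inj₂ refl) = ∨-introʳ (eqb v c) (∨-introˡ _ (eqb-refl v))
  IsEnd⇒share (a , b) (c , d) v (inj₂ refl) (inj₁ refl) =
    ∨-introʳ (eqb a v) (∨-introʳ (eqb a d) (∨-introˡ _ (eqb-refl v)))
  IsEnd⇒share (a , b) (c , d) v (inj₂ refl) (inj₂ refl) =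
    ∨-introʳ (eqb a c) (∨-introʳ (eqb a v) (∨-introʳ (eqb v c) (eqb-refl v)))

SameEdge-map : ∀ {m k} (h : Fin m → Fin k) {p q : Fin m × Fin m}
             → SameEdge p q → SameEdge (h (proj₁ p) , h (proj₂ p)) (h (proj₁ q) , h (proj₂ q))
SameEdge-map h (inj₁ (a , b)) = inj₁ (cong h a , cong h b)
SameEdge-map h (inj₂ (a , b)) = inj₂ (cong h a , cong h b)

module Edges (F : Graph) where
  private
    V = Fin (n F)

    ordered : V → V → Bool
    ordered i j = (toℕ i <ᵇ toℕ j) ∧ adj F i j

    row : V → V → List (V × V)
    row i j = if ordered i j then [ (i , j) ] else []

    rows : V → List (V × V)
    rows i = concatMap (row i) (allFin (n F))

    ∈-edges⁻ : ∀ {p} → p ∈ edges F → ∃₂ λ i j → p ≡ (i , j) × ordered i j ≡ true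
    ∈-edges⁻ p∈ with find (∈-concatMap⁻ rows {xs = allFin (n F)} p∈)
    ... | i , _ , p∈i with find (∈-concatMap⁻ (row i) {xs = allFin (n F)} p∈i)
    ...   | j , _ , p∈ij with ∈-if⁻ (ordered i j) p∈ij
    ...     | ord , p≡ij = i , j , p≡ij , ord

    ∈-edges⁺ : ∀ i j → ordered i j ≡ true → (i , j) ∈ edges F
    ∈-edges⁺ i j ord = ∈-concatMap⁺ rows (Any.map (λ { refl →
                       ∈-concatMap⁺ (row i) (Any.map (λ { refl → ∈-if⁺ ord }) (∈-allFin j)) }) (∈-allFin i))

    ∈-rows⇒fst : ∀ {i p} → p ∈ rows i → proj₁ p ≡ i
    ∈-rows⇒fst {i} p∈ with find (∈-concatMap⁻ (row i) {xs = allFin (n F)} p∈)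
    ... | j , _ , p∈ij = cong proj₁ (proj₂ (∈-if⁻ (ordered i j) p∈ij))

    row-unique : ∀ i j → Unique (row i j)
    row-unique i j with ordered i j
    ... | true  = [] ∷ []
    ... | false = []

    edges-unique : Unique (edges F)
    edges-unique =
      concatMap-unique rows (allFin⁺ (n F))
        (λ i → concatMap-unique (row i) (allFin⁺ (n F)) (row-unique i)
                 (λ {j} {j′} p∈ p∈′ → trans (sym (cong proj₂ (proj₂ (∈-if⁻ (ordered i j) p∈))))
                                            (cong proj₂ (proj₂ (∈-if⁻ (ordered i j′) p∈′)))))
        (λ p∈ p∈′ → trans (sym (∈-rows⇒fst p∈)) (∈-rows⇒fst p∈′))

    ordered⇒ : ∀ {i j} → ordered i j ≡ true → toℕ i < toℕ j × Adj F i j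
    ordered⇒ {i} {j} ord with ∧⇒× {toℕ i <ᵇ toℕ j} ord
    ... | lt , ij = <ᵇ⇒< (toℕ i) (toℕ j) (subst Data.Bool.T (sym lt) tt) , ij

    ⇒ordered : ∀ {i j} → toℕ i < toℕ j → Adj F i j → ordered i j ≡ true
    ⇒ordered {i} {j} lt ij with toℕ i <ᵇ toℕ j | <⇒<ᵇ lt
    ... | true | _ = ij

  Edge : Set
  Edge = Fin (length (edges F))

  ends : Edge → V × V
  ends k = lookup (edges F) k

  private
    ends-ordered : ∀ k → toℕ (proj₁ (ends k)) < toℕ (proj₂ (ends k)) × Adj F (proj₁ (ends k)) (proj₂ (ends k))
    ends-ordered k with ∈-edges⁻ (∈-lookup {xs = edges F} k)
    ... | i , j , eq , ord rewrite eq = ordered⇒ ord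

  ends-adj : ∀ k → Adj F (proj₁ (ends k)) (proj₂ (ends k))
  ends-adj k = proj₂ (ends-ordered k)

  opaque
    edgeOf : ∀ {i j} → Adj F i j → ∃ λ k → SameEdge (ends k) (i , j)
    edgeOf {i} {j} ij with <-cmp (toℕ i) (toℕ j)
    ... | tri< lt _ _ = let ij∈ = ∈-edges⁺ i j (⇒ordered lt ij) ; eq = lookup-index ij∈ in
                        Any.index ij∈ , inj₁ (cong proj₁ (sym eq) , cong proj₂ (sym eq))
    ... | tri≈ _ eq _ = ⊥-elim (Adj-irrefl F (subst (Adj F i) (sym (toℕ-injective eq)) ij))
    ... | tri> _ _ gt = let ji∈ = ∈-edges⁺ j i (⇒ordered gt (Adj-sym F ij)) ; eq = lookup-index ji∈ in
                        Any.index ji∈ , inj₂ (cong proj₁ (sym eq) , cong proj₂ (sym eq))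

  ends-injective : ∀ {k l} → SameEdge (ends k) (ends l) → k ≡ l
  ends-injective {k} {l} (inj₁ (e₁ , e₂)) = lookup-injective edges-unique k l (cong₂ _,_ e₁ e₂)
  ends-injective {k} {l} (inj₂ (e₁ , e₂)) =
    ⊥-elim (<-asym (subst₂ (λ p q → toℕ p < toℕ q) e₁ e₂ (proj₁ (ends-ordered k))) (proj₁ (ends-ordered l)))

  Incident : V → Edge → Set
  Incident v k = IsEnd v (ends k)

  lineAdj⇒ : ∀ {k l} → Adj (lineGraph F) k l → k ≢ l × ∃ λ v → Incident v k × Incident v l
  lineAdj⇒ {k} {l} kl with ∧⇒× {not (eqb k l)} kl
  ... | k≢l , shared = not-eqb⇒≢ k≢l , share⇒IsEnd (ends k) (ends l) shared

  ⇒lineAdj : ∀ {k l v} → k ≢ l → Incident v k → Incident v l → Adj (lineGraph F) k l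
  ⇒lineAdj {k} {l} {v} k≢l vk vl rewrite ≢⇒eqb k≢l = IsEnd⇒share (ends k) (ends l) v vk vl

-- From a decomposition of L(H) to one of H

suc+suc≡2*+1 : ∀ w → suc w + suc w ≡ suc (2 * w + 1)
suc+suc≡2*+1 w rewrite +-suc w w | +-identityʳ w | +-comm (w + w) 1 = refl

module FromLineGraph (H : Graph) {w : ℕ} (D : TwAtMost (lineGraph H) w) where
  open Edges H
  open TreeDecomposition D using (vtx-cover; edge-cover)
    renaming (tree to T; isTree to T-isTree; bag to edgeBag; bag-size to edgeBag-size; connected to edgeBag-connected)

  private
    endsList : Edge → List (Fin (n H))
    endsList k = proj₁ (ends k) ∷ proj₂ (ends k) ∷ []

    vertexBag : Fin (n T) → List (Fin (n H))
    vertexBag t = concatMap endsList (edgeBag t)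

    length-vertexBag : ∀ ks → length (concatMap endsList ks) ≡ length ks + length ks
    length-vertexBag []       = refl
    length-vertexBag (k ∷ ks) rewrite length-vertexBag ks | +-suc (length ks) (length ks) = refl

    vertexBag-size : ∀ t → length (vertexBag t) ≤ suc (2 * w + 1)
    vertexBag-size t rewrite length-vertexBag (edgeBag t) | sym (suc+suc≡2*+1 w) =
      +-mono-≤ (edgeBag-size t) (edgeBag-size t)

    ∈-vertexBag⁻ : ∀ {v t} → v ∈ vertexBag t → ∃ λ k → k ∈ edgeBag t × Incident v k
    ∈-vertexBag⁻ {v} {t} v∈ with find (∈-concatMap⁻ endsList {xs = edgeBag t} v∈)
    ... | k , k∈ , here v≡         = k , k∈ , inj₁ v≡
    ... | k , k∈ , there (here v≡) = k , k∈ , inj₂ v≡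

    ∈-vertexBag⁺ : ∀ {v t k} → k ∈ edgeBag t → Incident v k → v ∈ vertexBag t
    ∈-vertexBag⁺ {v} {t} {k} k∈ vk = ∈-concatMap⁺ endsList (Any.map (λ { refl → ∈-endsList vk }) k∈)
      where
      ∈-endsList : Incident v k → v ∈ endsList k
      ∈-endsList (inj₁ v≡) = here v≡
      ∈-endsList (inj₂ v≡) = there (here v≡)

    -- Two edges at v lie in a common bag, so their subtrees meet.
    vertexBag-connected : ∀ v t t′ → v ∈ vertexBag t → v ∈ vertexBag t′
                        → Reach T (λ s → v ∈ vertexBag s) t t′
    vertexBag-connected v t t′ v∈t v∈t′ with ∈-vertexBag⁻ v∈t | ∈-vertexBag⁻ v∈t′
    ... | k , k∈t , vk | k′ , k′∈t′ , vk′ with k ≟F k′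
    ...   | yes refl = Reach-mono (λ k∈ → ∈-vertexBag⁺ k∈ vk) (edgeBag-connected k t t′ k∈t k′∈t′)
    ...   | no k≢k′ with edge-cover k k′ (⇒lineAdj k≢k′ vk vk′)
    ...     | t″ , k∈t″ , k′∈t″ =
      Reach-mono (λ k∈ → ∈-vertexBag⁺ k∈ vk) (edgeBag-connected k t t″ k∈t k∈t″)
      ⁀ Reach-mono (λ k∈ → ∈-vertexBag⁺ k∈ vk′) (edgeBag-connected k′ t″ t′ k′∈t″ k′∈t′)

  vertexBagTree : BagTree H (2 * w + 1)
  vertexBagTree = record
    { tree = T ; isTree = T-isTree ; bag = vertexBag ; bag-size = vertexBag-size ; connected = vertexBag-connected }

  vertexBagTree-edgesCovered : EdgesCovered vertexBagTree
  vertexBagTree-edgesCovered u v uv with edgeOf uv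
  ... | k , same with vtx-cover k
  ...   | t , k∈t = t , ∈-vertexBag⁺ k∈t (IsEnd-SameEdge (inj₁ refl) (SameEdge-sym same))
                      , ∈-vertexBag⁺ k∈t (IsEnd-SameEdge (inj₂ refl) (SameEdge-sym same))

treewidth≤2*lineGraph+1 : ∀ {H w} → TwAtMost (lineGraph H) w → TwAtMost H (2 * w + 1)
treewidth≤2*lineGraph+1 {H} D =
  toTreeDecomposition vertexBagTree vertexBagTree-edgesCovered
  where open FromLineGraph H D

-- Contractions

-- G arises from B by contracting everything outside Inside to the single vertex v,
-- where each inside vertex has at most one neighbour outside.
record Contraction (B G : Graph) (v : Fin (n G)) : Set₁ where
  field
    Inside      : Fin (n B) → Set
    inside?     : Decidable Inside
    π           : Fin (n B) → Fin (n G)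
    π-adj       : ∀ {P Q} → Adj B P Q → Inside P ⊎ Inside Q → Adj G (π P) (π Q)
    π-injective : ∀ {P Q} → Inside P → Inside Q → π P ≡ π Q → P ≡ Q
    π-inside    : ∀ {P} → Inside P → π P ≢ v
    π-outside   : ∀ {P} → ¬ Inside P → π P ≡ v
    one-exit    : ∀ {P Q Q′} → Inside P → Adj B P Q → Adj B P Q′ → ¬ Inside Q → ¬ Inside Q′ → Q ≡ Q′
    π-lift      : ∀ {p q} → Adj G p q → ∃₂ λ P Q → Adj B P Q × π P ≡ p × π Q ≡ q

-- L(G) is the subgraph of L(B) induced by the edges touching the inside.
module LiftEdges {B G : Graph} {v : Fin (n G)} (C : Contraction B G v) where
  open Contraction C
  module EG = Edges G
  module EB = Edges B

  π² : Fin (n B) × Fin (n B) → Fin (n G) × Fin (n G)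
  π² (P , Q) = π P , π Q

  TouchesInside : EB.Edge → Set
  TouchesInside y = Inside (proj₁ (EB.ends y)) ⊎ Inside (proj₂ (EB.ends y))

  Incident⇒TouchesInside : ∀ {W y} → EB.Incident W y → Inside W → TouchesInside y
  Incident⇒TouchesInside (inj₁ refl) W-in = inj₁ W-in
  Incident⇒TouchesInside (inj₂ refl) W-in = inj₂ W-in

  opaque
    lift : EG.Edge → EB.Edge
    lift k with π-lift (EG.ends-adj k)
    ... | P , Q , PQ , _ = proj₁ (EB.edgeOf PQ)

    π²-lift : ∀ k → SameEdge (π² (EB.ends (lift k))) (EG.ends k)
    π²-lift k with π-lift (EG.ends-adj k)
    ... | P , Q , PQ , πP≡ , πQ≡ =
      subst₂ (λ p q → SameEdge (π² (EB.ends (proj₁ (EB.edgeOf PQ)))) (p , q)) πP≡ πQ≡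
        (SameEdge-map π (proj₂ (EB.edgeOf PQ)))

  lift-injective : ∀ {k k′} → lift k ≡ lift k′ → k ≡ k′
  lift-injective {k} {k′} eq =
    EG.ends-injective (SameEdge-trans (SameEdge-sym (π²-lift k))
                                      (subst (λ y → SameEdge (π² (EB.ends y)) (EG.ends k′)) (sym eq) (π²-lift k′)))

  π-Incident : ∀ {W k} → EB.Incident W (lift k) → EG.Incident (π W) k
  π-Incident {k = k} (inj₁ refl) = IsEnd-SameEdge (inj₁ refl) (π²-lift k)
  π-Incident {k = k} (inj₂ refl) = IsEnd-SameEdge (inj₂ refl) (π²-lift k)

  outside-Incident : ∀ {W k} → EB.Incident W (lift k) → ¬ Inside W → EG.Incident v k
  outside-Incident {k = k} Wk W-out = subst (λ u → EG.Incident u k) (π-outside W-out) (π-Incident Wk)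

  lift-touchesInside : ∀ k → TouchesInside (lift k)
  lift-touchesInside k with inside? (proj₁ (EB.ends (lift k))) | inside? (proj₂ (EB.ends (lift k)))
  ... | yes P-in | _        = inj₁ P-in
  ... | no  _    | yes Q-in = inj₂ Q-in
  ... | no P-out | no Q-out with π²-lift k
  ...   | inj₁ (P≡ , Q≡) = ⊥-elim (Adj-irrefl G (subst₂ (Adj G) (trans (sym P≡) (π-outside P-out))
                                                             (trans (sym Q≡) (π-outside Q-out)) (EG.ends-adj k)))
  ...   | inj₂ (P≡ , Q≡) = ⊥-elim (Adj-irrefl G (subst₂ (Adj G) (trans (sym Q≡) (π-outside Q-out))
                                                             (trans (sym P≡) (π-outside P-out)) (EG.ends-adj k)))

  private
    inside-edge-determined : ∀ {P Q P′ Q′} → Inside P → Adj B P Q → Adj B P′ Q′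
                           → π P′ ≡ π P → π Q′ ≡ π Q → P′ ≡ P × Q′ ≡ Q
    inside-edge-determined {P} {Q} {P′} {Q′} P-in PQ P′Q′ πP′≡ πQ′≡ with inside? P′
    ... | no P′-out = ⊥-elim (π-inside P-in (trans (sym πP′≡) (π-outside P′-out)))
    ... | yes P′-in with π-injective P′-in P-in πP′≡
    ...   | refl with inside? Q | inside? Q′
    ...     | yes Q-in  | yes Q′-in  = refl , π-injective Q′-in Q-in πQ′≡
    ...     | yes Q-in  | no  Q′-out = ⊥-elim (π-inside Q-in (trans (sym πQ′≡) (π-outside Q′-out)))
    ...     | no  Q-out | yes Q′-in  = ⊥-elim (π-inside Q′-in (trans πQ′≡ (π-outside Q-out)))
    ...     | no  Q-out | no  Q′-out = refl , one-exit P-in P′Q′ PQ Q′-out Q-out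

  lift-onto : ∀ y → TouchesInside y → ∃ λ k → lift k ≡ y
  lift-onto y touches with EG.edgeOf (π-adj (EB.ends-adj y) touches)
  ... | k , same = k , EB.ends-injective (ends-same touches (SameEdge-trans (π²-lift k) same))
    where
    PQ   = EB.ends-adj y
    P′Q′ = EB.ends-adj (lift k)
    ends-same : TouchesInside y → SameEdge (π² (EB.ends (lift k))) (π² (EB.ends y))
              → SameEdge (EB.ends (lift k)) (EB.ends y)
    ends-same (inj₁ P-in) (inj₁ (e₁ , e₂)) = inj₁ (inside-edge-determined P-in PQ P′Q′ e₁ e₂)
    ends-same (inj₁ P-in) (inj₂ (e₁ , e₂)) with inside-edge-determined P-in PQ (Adj-sym B P′Q′) e₂ e₁
    ... | p , q = inj₂ (q , p)
    ends-same (inj₂ Q-in) (inj₁ (e₁ , e₂))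
      with inside-edge-determined Q-in (Adj-sym B PQ) (Adj-sym B P′Q′) e₂ e₁
    ... | p , q = inj₁ (q , p)
    ends-same (inj₂ Q-in) (inj₂ (e₁ , e₂)) = inj₂ (inside-edge-determined Q-in (Adj-sym B PQ) P′Q′ e₁ e₂)

  module Transfer {w : ℕ} (D : TwAtMost (lineGraph G) w) where
    open TreeDecomposition D using (edge-cover)
      renaming (tree to T; isTree to T-isTree; bag to edgeBag; bag-size to edgeBag-size; connected to edgeBag-connected)

    liftedBag : Fin (n T) → List EB.Edge
    liftedBag t = map lift (edgeBag t)

    private

      liftedBag-size : ∀ t → length (liftedBag t) ≤ suc w
      liftedBag-size t rewrite length-map lift (edgeBag t) = edgeBag-size t

      liftedBag-connected : ∀ y t t′ → y ∈ liftedBag t → y ∈ liftedBag t′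
                          → Reach T (λ s → y ∈ liftedBag s) t t′
      liftedBag-connected y t t′ y∈t y∈t′ with ∈-map⁻ lift y∈t | ∈-map⁻ lift y∈t′
      ... | k , k∈t , refl | k′ , k′∈t′ , eq with lift-injective eq
      ...   | refl = Reach-mono (∈-map⁺ lift) (edgeBag-connected k t t′ k∈t k′∈t′)

    lifted : BagTree (lineGraph B) w
    lifted = record
      { tree = T ; isTree = T-isTree ; bag = liftedBag ; bag-size = liftedBag-size ; connected = liftedBag-connected }

    lift-∈ : ∀ {k t} → k ∈ edgeBag t → lift k ∈ liftedBag t
    lift-∈ = ∈-map⁺ lift

    ∈-liftedBag⇒insideEnd : ∀ {y t} → y ∈ liftedBag t → ∃ λ W → EB.Incident W y × Inside W
    ∈-liftedBag⇒insideEnd y∈ with ∈-map⁻ lift y∈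
    ... | k , _ , refl with lift-touchesInside k
    ...   | inj₁ P-in = _ , inj₁ refl , P-in
    ...   | inj₂ Q-in = _ , inj₂ refl , Q-in

    ∈-liftedBag-outsideEnd : ∀ {y t W} → y ∈ liftedBag t → EB.Incident W y → ¬ Inside W
                           → ∃ λ k → lift k ≡ y × EG.Incident v k
    ∈-liftedBag-outsideEnd y∈ Wy W-out with ∈-map⁻ lift y∈
    ... | k , _ , refl = k , refl , outside-Incident Wy W-out

    lifted-covers : ∀ {y y′ W} → y ≢ y′ → EB.Incident W y → EB.Incident W y′ → Inside W
                  → ∃ λ t → y ∈ liftedBag t × y′ ∈ liftedBag t
    lifted-covers y≢y′ Wy Wy′ W-in
      with lift-onto _ (Incident⇒TouchesInside Wy W-in) | lift-onto _ (Incident⇒TouchesInside Wy′ W-in)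
    ... | k , refl | k′ , refl
      with edge-cover k k′ (EG.⇒lineAdj (λ k≡k′ → y≢y′ (cong lift k≡k′)) (π-Incident Wy) (π-Incident Wy′))
    ...   | t , k∈ , k′∈ = t , lift-∈ k∈ , lift-∈ k′∈

-- Gluing decompositions of line graphs

NbhdIs-adj : ∀ G v {x y z} → NbhdIs G v x y z → ∀ {u} → u ≡ x ⊎ u ≡ y ⊎ u ≡ z → Adj G v u
NbhdIs-adj G v N {u} = proj₂ (proj₂ N u)

NbhdIs-nbr : ∀ G v {x y z} → NbhdIs G v x y z → ∀ {u} → Adj G v u → u ≡ x ⊎ u ≡ y ⊎ u ≡ z
NbhdIs-nbr G v N {u} = proj₁ (proj₂ N u)

NbhdIs-≢ : ∀ G v {x y z} → NbhdIs G v x y z → ∀ {u} → u ≡ x ⊎ u ≡ y ⊎ u ≡ z → v ≢ u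
NbhdIs-≢ G v N u∈ refl = Adj-irrefl G (NbhdIs-adj G v N u∈)

module _ {G : Graph} {v : Fin (n G)} where
  open Edges G

  incident⇒neighbour : ∀ k → Incident v k → ∃ λ u → Adj G v u × SameEdge (ends k) (v , u)
  incident⇒neighbour k (inj₁ refl) = proj₂ (ends k) , ends-adj k , inj₁ (refl , refl)
  incident⇒neighbour k (inj₂ refl) = proj₁ (ends k) , Adj-sym G (ends-adj k) , inj₂ (refl , refl)

  private
    SameEdge⇒Incident : ∀ {k u} → SameEdge (ends k) (v , u) → Incident v k
    SameEdge⇒Incident same = IsEnd-SameEdge (inj₁ refl) (SameEdge-sym same)

    edgeAt-unique : ∀ {k l u} → SameEdge (ends k) (v , u) → SameEdge (ends l) (v , u) → k ≡ l
    edgeAt-unique same same′ = ends-injective (SameEdge-trans same (SameEdge-sym same′))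

    edgesAt-distinct : ∀ {k l u u′} → SameEdge (ends k) (v , u) → SameEdge (ends l) (v , u′) → Adj G v u′
                     → u ≢ u′ → k ≢ l
    edgesAt-distinct same same′ vu′ u≢u′ refl with SameEdge-trans (SameEdge-sym same) same′
    ... | inj₁ (_ , u≡u′) = u≢u′ u≡u′
    ... | inj₂ (v≡u′ , _) = Adj-irrefl G (subst (Adj G v) (sym v≡u′) vu′)

  edgesAt-inOneBag : ∀ {x y z} → NbhdIs G v x y z → ∀ {w} (D : TwAtMost (lineGraph G) w)
                   → ∃ λ t → ∀ k → Incident v k → k ∈ TreeDecomposition.bag D t
  edgesAt-inOneBag {x} {y} {z} N@((x≢y , x≢z , y≢z) , _) D
    with edgeOf (NbhdIs-adj G v N (inj₁ refl))
       | edgeOf (NbhdIs-adj G v N (inj₂ (inj₁ refl)))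
       | edgeOf (NbhdIs-adj G v N (inj₂ (inj₂ refl)))
  ... | kx , sx | ky , sy | kz , sz = t , at-t
    where
    open TreeDecomposition D
    open import Data.List.Membership.DecPropositional (_≟F_ {length (edges G)}) using (_∈?_)

    common : ∀ {k l} → k ≢ l → Incident v k → Incident v l → ∃ λ t → k ∈ bag t × l ∈ bag t
    common k≢l vk vl = edge-cover _ _ (⇒lineAdj k≢l vk vl)

    kx≢ky = edgesAt-distinct sx sy (NbhdIs-adj G v N (inj₂ (inj₁ refl))) x≢y
    kx≢kz = edgesAt-distinct sx sz (NbhdIs-adj G v N (inj₂ (inj₂ refl))) x≢z
    ky≢kz = edgesAt-distinct sy sz (NbhdIs-adj G v N (inj₂ (inj₂ refl))) y≢z

    open Helly tree (acyclic⇒edgesAreBridges tree (proj₂ (proj₂ isTree)))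
               {λ t → kx ∈ bag t} {λ t → ky ∈ bag t} {λ t → kz ∈ bag t}
               (λ t → kx ∈? bag t) (λ t → ky ∈? bag t) (connected kx) (connected ky) (connected kz)

    triple : ∃ λ t → kx ∈ bag t × ky ∈ bag t × kz ∈ bag t
    triple with common (λ e → kx≢kz (sym e)) (SameEdge⇒Incident sz) (SameEdge⇒Incident sx)
              | common (λ e → ky≢kz (sym e)) (SameEdge⇒Incident sz) (SameEdge⇒Incident sy)
              | common kx≢ky (SameEdge⇒Incident sx) (SameEdge⇒Incident sy)
    ... | p , kz∈p , kx∈p | q , kz∈q , ky∈q | r , kx∈r , ky∈r = helly kz∈p kx∈p kz∈q ky∈q kx∈r ky∈r

    t = proj₁ triple

    at-t : ∀ k → Incident v k → k ∈ bag t
    at-t k vk with incident⇒neighbour k vk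
    ... | u , vu , same with NbhdIs-nbr G v N vu
    ... | inj₁ refl        = subst (_∈ bag t) (edgeAt-unique sx same) (proj₁ (proj₂ triple))
    ... | inj₂ (inj₁ refl) = subst (_∈ bag t) (edgeAt-unique sy same) (proj₁ (proj₂ (proj₂ triple)))
    ... | inj₂ (inj₂ refl) = subst (_∈ bag t) (edgeAt-unique sz same) (proj₂ (proj₂ (proj₂ triple)))

module GlueAlongContractions {B G₁ G₂ : Graph} {v₁ : Fin (n G₁)} {v₂ : Fin (n G₂)}
  (C₁ : Contraction B G₁ v₁) (C₂ : Contraction B G₂ v₂)
  (inside₁⇒outside₂ : ∀ {P} → Contraction.Inside C₁ P → ¬ Contraction.Inside C₂ P)
  (outside₁⇒inside₂ : ∀ {P} → ¬ Contraction.Inside C₁ P → Contraction.Inside C₂ P)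
  {w : ℕ} (D₁ : TwAtMost (lineGraph G₁) w) (D₂ : TwAtMost (lineGraph G₂) w)
  (star₁ : ∃ λ t → ∀ k → Edges.Incident G₁ v₁ k → k ∈ TreeDecomposition.bag D₁ t)
  (star₂ : ∃ λ t → ∀ k → Edges.Incident G₂ v₂ k → k ∈ TreeDecomposition.bag D₂ t)
  where

  private
    module L₁ = LiftEdges C₁
    module L₂ = LiftEdges C₂
    module X₁ = L₁.Transfer D₁
    module X₂ = L₂.Transfer D₂
    open Edges B
    open Contraction using (Inside; inside?)
    t₁ = proj₁ star₁
    t₂ = proj₁ star₂

    -- An edge lifted from both sides has an end on each side, so it is incident to v₁ and to v₂.
    shared : ∀ y s s′ → y ∈ X₁.liftedBag s → y ∈ X₂.liftedBag s′
           → y ∈ X₁.liftedBag t₁ × y ∈ X₂.liftedBag t₂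
    shared y s s′ y∈₁ y∈₂ with X₁.∈-liftedBag⇒insideEnd y∈₁ | X₂.∈-liftedBag⇒insideEnd y∈₂
    ... | W₁ , W₁y , W₁-in | W₂ , W₂y , W₂-in
      with X₁.∈-liftedBag-outsideEnd y∈₁ W₂y (λ W₂-in₁ → inside₁⇒outside₂ W₂-in₁ W₂-in)
         | X₂.∈-liftedBag-outsideEnd y∈₂ W₁y (inside₁⇒outside₂ W₁-in)
    ... | k₁ , refl , v₁k₁ | k₂ , lift₂≡ , v₂k₂ =
      ∈-map⁺ L₁.lift (proj₂ star₁ k₁ v₁k₁) ,
      subst (_∈ X₂.liftedBag t₂) lift₂≡ (∈-map⁺ L₂.lift (proj₂ star₂ k₂ v₂k₂))

  open JoinBagTrees X₁.lifted X₂.lifted t₁ t₂ shared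

  joined-edgesCovered : EdgesCovered joined
  joined-edgesCovered y y′ yy′ with lineAdj⇒ yy′
  ... | y≢y′ , W , Wy , Wy′ with inside? C₁ W
  ...   | yes W-in₁ = let (t , y∈ , y′∈) = X₁.lifted-covers y≢y′ Wy Wy′ W-in₁
                          (t′ , ⊆) = ⊑-joinedˡ t in t′ , ⊆ y∈ , ⊆ y′∈
  ...   | no W-out₁ = let (t , y∈ , y′∈) = X₂.lifted-covers y≢y′ Wy Wy′ (outside₁⇒inside₂ W-out₁)
                          (t′ , ⊆) = ⊑-joinedʳ t in t′ , ⊆ y∈ , ⊆ y′∈

  lineGraph-decomposition : TwAtMost (lineGraph B) w
  lineGraph-decomposition = toTreeDecomposition joined joined-edgesCovered

-- The bridge operation

delEmb-injective : ∀ G v {a b} → delEmb G v a ≡ delEmb G v b → a ≡ b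
delEmb-injective (mkGraph (suc _) _ _ _) v = punchIn-injective v _ _

delEmb≢ : ∀ G v a → delEmb G v a ≢ v
delEmb≢ (mkGraph (suc _) _ _ _) v = punchInᵢ≢i v

delEmb-onto : ∀ G v {u} → v ≢ u → ∃ λ a → delEmb G v a ≡ u
delEmb-onto (mkGraph (suc _) _ _ _) v v≢u = punchOut v≢u , punchIn-punchOut v≢u

adj-del : ∀ G v a b → adj (del G v) a b ≡ adj G (delEmb G v a) (delEmb G v b)
adj-del (mkGraph (suc _) _ _ _) v a b = refl

module _ {m k : ℕ} (x y z : Fin m) (x′ y′ z′ : Fin k) where

  Matched : Fin m → Fin k → Set
  Matched u u′ = (u ≡ x × u′ ≡ x′) ⊎ (u ≡ y × u′ ≡ y′) ⊎ (u ≡ z × u′ ≡ z′)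

  matches : Fin m → Fin k → Bool
  matches u u′ = (eqb u x ∧ eqb u′ x′) ∨ (eqb u y ∧ eqb u′ y′) ∨ (eqb u z ∧ eqb u′ z′)

  matches⇒Matched : ∀ {u u′} → matches u u′ ≡ true → Matched u u′
  matches⇒Matched {u} {u′} eq with ∨⇒⊎ {eqb u x ∧ eqb u′ x′} eq
  ... | inj₁ mx = let (p , q) = ∧⇒× mx in inj₁ (eqb⇒≡ p , eqb⇒≡ q)
  ... | inj₂ eq′ with ∨⇒⊎ {eqb u y ∧ eqb u′ y′} eq′
  ...   | inj₁ my = let (p , q) = ∧⇒× my in inj₂ (inj₁ (eqb⇒≡ p , eqb⇒≡ q))
  ...   | inj₂ mz = let (p , q) = ∧⇒× {eqb u z} mz in inj₂ (inj₂ (eqb⇒≡ p , eqb⇒≡ q))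

  Matched⇒matches : ∀ {u u′} → Matched u u′ → matches u u′ ≡ true
  Matched⇒matches (inj₁ (refl , refl)) rewrite eqb-refl x | eqb-refl x′ = refl
  Matched⇒matches {u} {u′} (inj₂ (inj₁ (refl , refl))) rewrite eqb-refl y | eqb-refl y′ =
    ∨-introʳ (eqb u x ∧ eqb u′ x′) refl
  Matched⇒matches {u} {u′} (inj₂ (inj₂ (refl , refl))) rewrite eqb-refl z | eqb-refl z′ =
    ∨-introʳ (eqb u x ∧ eqb u′ x′) (∨-introʳ (eqb u y ∧ eqb u′ y′) refl)

matches-swap : ∀ {m k} (x y z : Fin m) (x′ y′ z′ : Fin k) u u′
             → matches x y z x′ y′ z′ u u′ ≡ matches x′ y′ z′ x y z u′ u
matches-swap x y z x′ y′ z′ u u′ =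
  cong₂ _∨_ (∧-comm (eqb u x) _) (cong₂ _∨_ (∧-comm (eqb u y) _) (∧-comm (eqb u z) _))

module _ (G : Graph) (v : Fin (n G)) {x y z : Fin (n G)} (N : NbhdIs G v x y z) where

  Matched⇒adj : ∀ {k} {x′ y′ z′ : Fin k} {u u′} → Matched x y z x′ y′ z′ u u′ → Adj G v u
  Matched⇒adj (inj₁ (u≡x , _))        = NbhdIs-adj G v N (inj₁ u≡x)
  Matched⇒adj (inj₂ (inj₁ (u≡y , _))) = NbhdIs-adj G v N (inj₂ (inj₁ u≡y))
  Matched⇒adj (inj₂ (inj₂ (u≡z , _))) = NbhdIs-adj G v N (inj₂ (inj₂ u≡z))

  Matched-functional : ∀ {k} {x′ y′ z′ : Fin k} {u u′ u″}
                     → Matched x y z x′ y′ z′ u u′ → Matched x y z x′ y′ z′ u u″ → u′ ≡ u″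
  Matched-functional {k} {x′} {y′} {z′} = go
    where
    x≢y = proj₁ (proj₁ N) ; x≢z = proj₁ (proj₂ (proj₁ N)) ; y≢z = proj₂ (proj₂ (proj₁ N))
    go : ∀ {u u′ u″} → Matched x y z x′ y′ z′ u u′ → Matched x y z x′ y′ z′ u u″ → u′ ≡ u″
    go (inj₁ (_ , p))        (inj₁ (_ , q))        = trans p (sym q)
    go (inj₂ (inj₁ (_ , p))) (inj₂ (inj₁ (_ , q))) = trans p (sym q)
    go (inj₂ (inj₂ (_ , p))) (inj₂ (inj₂ (_ , q))) = trans p (sym q)
    go (inj₁ (a , _))        (inj₂ (inj₁ (b , _))) = ⊥-elim (x≢y (trans (sym a) b))
    go (inj₁ (a , _))        (inj₂ (inj₂ (b , _))) = ⊥-elim (x≢z (trans (sym a) b))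
    go (inj₂ (inj₁ (a , _))) (inj₁ (b , _))        = ⊥-elim (x≢y (trans (sym b) a))
    go (inj₂ (inj₁ (a , _))) (inj₂ (inj₂ (b , _))) = ⊥-elim (y≢z (trans (sym a) b))
    go (inj₂ (inj₂ (a , _))) (inj₁ (b , _))        = ⊥-elim (x≢z (trans (sym b) a))
    go (inj₂ (inj₂ (a , _))) (inj₂ (inj₁ (b , _))) = ⊥-elim (y≢z (trans (sym b) a))

  partner : ∀ (G′ : Graph) (v′ : Fin (n G′)) {x′ y′ z′} → NbhdIs G′ v′ x′ y′ z′
          → ∀ {u} → Adj G v u → ∃ λ u′ → Matched x y z x′ y′ z′ u u′ × v′ ≢ u′
  partner G′ v′ N′ vu with NbhdIs-nbr G v N vu
  ... | inj₁ refl        = _ , inj₁ (refl , refl)        , NbhdIs-≢ G′ v′ N′ (inj₁ refl)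
  ... | inj₂ (inj₁ refl) = _ , inj₂ (inj₁ (refl , refl)) , NbhdIs-≢ G′ v′ N′ (inj₂ (inj₁ refl))
  ... | inj₂ (inj₂ refl) = _ , inj₂ (inj₂ (refl , refl)) , NbhdIs-≢ G′ v′ N′ (inj₂ (inj₂ refl))

-- One side of a bridge: B contains copies ι of G - v and ι′ of G′ - v′, joined by a perfect
-- matching between N(v) and N(v′); contracting the copy of G′ - v′ to v gives back G.
module BridgeSide
  {G G′ B : Graph} {v x y z : Fin (n G)} {v′ x′ y′ z′ : Fin (n G′)}
  (N : NbhdIs G v x y z) (N′ : NbhdIs G′ v′ x′ y′ z′)
  (ι : Fin (n (del G v)) → Fin (n B)) (ι′ : Fin (n (del G′ v′)) → Fin (n B))
  (ι-injective : ∀ {a b} → ι a ≡ ι b → a ≡ b)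
  (ι≢ι′ : ∀ {a b} → ι a ≢ ι′ b)
  (ι⊎ι′ : ∀ P → (∃ λ a → P ≡ ι a) ⊎ (∃ λ b → P ≡ ι′ b))
  (adj-ιι : ∀ a b → adj B (ι a) (ι b) ≡ adj G (delEmb G v a) (delEmb G v b))
  (adj-ιι′ : ∀ a b → adj B (ι a) (ι′ b) ≡ matches x y z x′ y′ z′ (delEmb G v a) (delEmb G′ v′ b))
  where

  private
    p  = delEmb G v
    p′ = delEmb G′ v′

    Inside : Fin (n B) → Set
    Inside P = ∃ λ a → P ≡ ι a

    outside⇒ι′ : ∀ {P} → ¬ Inside P → ∃ λ b → P ≡ ι′ b
    outside⇒ι′ {P} P-out with ι⊎ι′ P
    ... | inj₁ P-in = ⊥-elim (P-out P-in)
    ... | inj₂ P≡ι′ = P≡ι′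

    π : Fin (n B) → Fin (n G)
    π P = [ (λ (a , _) → p a) , (λ _ → v) ]′ (ι⊎ι′ P)

    π-ι : ∀ a → π (ι a) ≡ p a
    π-ι a with ι⊎ι′ (ι a)
    ... | inj₁ (a′ , ιa≡ιa′) = cong p (sym (ι-injective ιa≡ιa′))
    ... | inj₂ (b , ιa≡ι′b)  = ⊥-elim (ι≢ι′ ιa≡ι′b)

    π-ι′ : ∀ b → π (ι′ b) ≡ v
    π-ι′ b with ι⊎ι′ (ι′ b)
    ... | inj₁ (a , ι′b≡ιa) = ⊥-elim (ι≢ι′ (sym ι′b≡ιa))
    ... | inj₂ _            = refl

    Adj-ιι′⇒Matched : ∀ {a b} → Adj B (ι a) (ι′ b) → Matched x y z x′ y′ z′ (p a) (p′ b)
    Adj-ιι′⇒Matched {a} {b} ab = matches⇒Matched x y z x′ y′ z′ (trans (sym (adj-ιι′ a b)) ab)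

    Matched⇒Adj-ιι′ : ∀ {a b} → Matched x y z x′ y′ z′ (p a) (p′ b) → Adj B (ι a) (ι′ b)
    Matched⇒Adj-ιι′ {a} {b} m = trans (adj-ιι′ a b) (Matched⇒matches x y z x′ y′ z′ m)

    π-adj : ∀ {P Q} → Adj B P Q → Inside P ⊎ Inside Q → Adj G (π P) (π Q)
    π-adj {P} {Q} PQ P-or-Q-in with ι⊎ι′ P | ι⊎ι′ Q
    ... | inj₁ (a , refl) | inj₁ (b , refl) = trans (sym (adj-ιι a b)) PQ
    ... | inj₁ (a , refl) | inj₂ (b , refl) = Adj-sym G (Matched⇒adj G v N (Adj-ιι′⇒Matched PQ))
    ... | inj₂ (b , refl) | inj₁ (a , refl) = Matched⇒adj G v N (Adj-ιι′⇒Matched (Adj-sym B PQ))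
    ... | inj₂ (b , refl) | inj₂ (b′ , refl) with P-or-Q-in
    ...   | inj₁ (a , ι′b≡ιa)  = ⊥-elim (ι≢ι′ (sym ι′b≡ιa))
    ...   | inj₂ (a , ι′b′≡ιa) = ⊥-elim (ι≢ι′ (sym ι′b′≡ιa))

    π-injective : ∀ {P Q} → Inside P → Inside Q → π P ≡ π Q → P ≡ Q
    π-injective (a , refl) (b , refl) πa≡πb =
      cong ι (delEmb-injective G v (trans (sym (π-ι a)) (trans πa≡πb (π-ι b))))

    π-inside : ∀ {P} → Inside P → π P ≢ v
    π-inside (a , refl) πa≡v = delEmb≢ G v a (trans (sym (π-ι a)) πa≡v)

    π-outside : ∀ {P} → ¬ Inside P → π P ≡ v
    π-outside P-out with outside⇒ι′ P-out
    ... | b , refl = π-ι′ b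

    one-exit : ∀ {P Q Q′} → Inside P → Adj B P Q → Adj B P Q′ → ¬ Inside Q → ¬ Inside Q′ → Q ≡ Q′
    one-exit (a , refl) PQ PQ′ Q-out Q′-out with outside⇒ι′ Q-out | outside⇒ι′ Q′-out
    ... | b , refl | b′ , refl =
      cong ι′ (delEmb-injective G′ v′
        (Matched-functional G v N (Adj-ιι′⇒Matched PQ) (Adj-ιι′⇒Matched PQ′)))

    -- an edge vq of G comes from the matching edge at q
    π-lift-at-v : ∀ {q} → Adj G v q → ∃₂ λ P Q → Adj B P Q × π P ≡ v × π Q ≡ q
    π-lift-at-v {q} vq with delEmb-onto G v (λ v≡q → Adj-irrefl G (subst (Adj G v) (sym v≡q) vq))
    ... | a , refl with partner G v N G′ v′ N′ vq
    ...   | q′ , m , v′≢q′ with delEmb-onto G′ v′ v′≢q′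
    ...     | b , refl = ι′ b , ι a , Adj-sym B (Matched⇒Adj-ιι′ m) , π-ι′ b , π-ι a

    π-lift : ∀ {q r} → Adj G q r → ∃₂ λ P Q → Adj B P Q × π P ≡ q × π Q ≡ r
    π-lift {q} {r} qr with q ≟F v | r ≟F v
    ... | yes refl | yes refl = ⊥-elim (Adj-irrefl G qr)
    ... | yes refl | no _     = π-lift-at-v qr
    ... | no _     | yes refl with π-lift-at-v (Adj-sym G qr)
    ...   | P , Q , PQ , πP≡ , πQ≡ = Q , P , Adj-sym B PQ , πQ≡ , πP≡
    π-lift {q} {r} qr | no q≢v | no r≢v
      with delEmb-onto G v (λ v≡q → q≢v (sym v≡q)) | delEmb-onto G v (λ v≡r → r≢v (sym v≡r))
    ... | a , refl | b , refl = ι a , ι b , trans (adj-ιι a b) qr , π-ι a , π-ι b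

  contraction : Contraction B G v
  contraction = record
    { Inside      = Inside
    ; inside?     = λ P → [ yes , (λ (b , P≡ι′b) → no λ (a , P≡ιa) → ι≢ι′ (trans (sym P≡ιa) P≡ι′b)) ]′ (ι⊎ι′ P)
    ; π           = π
    ; π-adj       = π-adj
    ; π-injective = π-injective
    ; π-inside    = π-inside
    ; π-outside   = π-outside
    ; one-exit    = one-exit
    ; π-lift      = π-lift
    }

module _ {G₁ G₂ : Graph} {v₁ x₁ y₁ z₁ : Fin (n G₁)} {v₂ x₂ y₂ z₂ : Fin (n G₂)}
  (N₁ : NbhdIs G₁ v₁ x₁ y₁ z₁) (N₂ : NbhdIs G₂ v₂ x₂ y₂ z₂) where

  private
    B  = bridge G₁ G₂ v₁ x₁ y₁ z₁ v₂ x₂ y₂ z₂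
    m₁ = n (del G₁ v₁)
    m₂ = n (del G₂ v₂)
    -- the adjacency between the two sides of `bridge`, unfolded
    open Union (del G₁ v₁) (del G₂ v₂)
      (λ a b → matches x₁ y₁ z₁ x₂ y₂ z₂ (delEmb G₁ v₁ a) (delEmb G₂ v₂ b))

    side₁ : Contraction B G₁ v₁
    side₁ = BridgeSide.contraction N₁ N₂ (_↑ˡ m₂) (m₁ ↑ʳ_) (↑ˡ-injective m₂ _ _) ↑ˡ≢↑ʳ (split m₁ m₂)
      (λ a b → trans (adj-↑ˡ↑ˡ a b) (adj-del G₁ v₁ a b)) adj-↑ˡ↑ʳ

    side₂ : Contraction B G₂ v₂
    side₂ = BridgeSide.contraction N₂ N₁ (m₁ ↑ʳ_) (_↑ˡ m₂) (↑ʳ-injective m₁ _ _) (λ eq → ↑ˡ≢↑ʳ (sym eq))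
      (λ i → swap (split m₁ m₂ i))
      (λ a b → trans (adj-↑ʳ↑ʳ a b) (adj-del G₂ v₂ a b))
      (λ b a → trans (adj-↑ʳ↑ˡ a b) (matches-swap x₁ y₁ z₁ x₂ y₂ z₂ (delEmb G₁ v₁ a) (delEmb G₂ v₂ b)))

  lineGraph-bridge : ∀ {w} → TwAtMost (lineGraph G₁) w → TwAtMost (lineGraph G₂) w
                   → TwAtMost (lineGraph (bridge G₁ G₂ v₁ x₁ y₁ z₁ v₂ x₂ y₂ z₂)) w
  lineGraph-bridge D₁ D₂ =
    GlueAlongContractions.lineGraph-decomposition side₁ side₂
      (λ { (a , refl) (b , eq) → ↑ˡ≢↑ʳ eq })
      (λ {P} P-out → [ (λ P-in → ⊥-elim (P-out P-in)) , (λ P-in₂ → P-in₂) ]′ (split m₁ m₂ P))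
      D₁ D₂ (edgesAt-inOneBag N₁ D₁) (edgesAt-inOneBag N₂ D₂)

lineGraph-closure : ∀ {w} (B : Graph → Set) → (∀ H → B H → TwAtMost (lineGraph H) w)
                  → ∀ {G} → BridgeClosure B G → TwAtMost (lineGraph G) w
lineGraph-closure B base-tw (base B-G)             = base-tw _ B-G
lineGraph-closure B base-tw (bridged C₁ C₂ N₁ N₂) =
  lineGraph-bridge N₁ N₂ (lineGraph-closure B base-tw C₁) (lineGraph-closure B base-tw C₂)

theorem14 : (w : ℕ) (B : Graph → Set)
    → (∀ H → B H → TwAtMost (lineGraph H) w)
    → ∀ G → BridgeClosure B G → TwAtMost G (2 * w + 1)
theorem14 w B base-tw G G∈C = treewidth≤2*lineGraph+1 (lineGraph-closure B base-tw G∈C)
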